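{- Let $\mathbb{F}_q$ be a finite field, $n\ge1$, and $U,W$ subspaces of $(\mathbb{F}_q)^n$ with $j=\dim U$, $k=\dim(U+W)$, and let $j\le l\le n$. Choose $U^+$ uniformly at random among subspaces of dimension $l$ containing $U$ and set $Y=U^++W$, $m=\dim Y$. Then conditionally on $Y$, the law of $U^+$ is the uniform law on the subspaces $U^+$ satisfying $$\dim U^+=l,\qquad U\subset U^+\subset Y,\qquad U^++W=Y,$$ and the number of such subspaces is $$q^{(m-l)(l-j)}\,\frac{(q^{ -1})_{k-j}}{(q^{ -1})_{m-l}\,(q^{ -1})_{k+l-j-m}}.$$
   Context: $(x)_m=(1-x)(1-x^2)\cdots(1-x^m)$ for $m\ge0$, $(x)_0=1$. -}

module Defs where

open import Level using (Level; _⊔_) renaming (suc to lsuc)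
open import Algebra.Bundles using (CommutativeRing)
open import Data.Nat as ℕ using (ℕ; zero; suc)
open import Data.Integer using (+_)
open import Data.Fin using (Fin)
open import Data.Vec using (Vec; []; _∷_; replicate; zipWith; map; _++_)
open import Data.Vec.Relation.Binary.Pointwise.Inductive using (Pointwise)
open import Data.Vec.Relation.Unary.All using (All)
open import Data.Product using (Σ; ∃; _×_; _,_)
open import Relation.Nullary using (¬_)
open import Relation.Binary.PropositionalEquality using (_≡_)
open import Data.Rational as ℚ using (ℚ; 0ℚ; 1ℚ)

record IsField {c ℓ : Level} (R : CommutativeRing c ℓ) : Set (c ⊔ ℓ) where
  open CommutativeRing R
  field
    0≉1     : ¬ (0# ≈ 1#)
    inverse : ∀ x → ¬ (x ≈ 0#) → Σ Carrier λ y → (x * y) ≈ 1#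

record FiniteField (c ℓ : Level) : Set (lsuc (c ⊔ ℓ)) where
  field
    cring    : CommutativeRing c ℓ
    isField  : IsField cring
  open CommutativeRing cring public hiding (ring)
  field
    q        : ℕ
    enum     : Fin q → Carrier
    complete : ∀ x → ∃ λ i → x ≈ enum i
    distinct : ∀ i j → enum i ≈ enum j → i ≡ j

-- Linear algebra in (F_q)^n.  A subspace is presented by a finite
-- generating family (every subspace of a finite-dimensional space is
-- finitely generated); subspaces are compared extensionally.

module Linear {c ℓ : Level} (F : FiniteField c ℓ) (n : ℕ) where
  open FiniteField F

  Vect : Set c
  Vect = Vec Carrier n

  _≈ᵥ_ : Vect → Vect → Set (c ⊔ ℓ)
  u ≈ᵥ v = Pointwise _≈_ u v

  0ᵥ : Vect
  0ᵥ = replicate n 0#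

  _+ᵥ_ : Vect → Vect → Vect
  u +ᵥ v = zipWith _+_ u v

  _·ᵥ_ : Carrier → Vect → Vect
  a ·ᵥ v = map (a *_) v

  lincomb : ∀ {d} → Vec Carrier d → Vec Vect d → Vect
  lincomb [] [] = 0ᵥ
  lincomb (a ∷ as) (v ∷ vs) = (a ·ᵥ v) +ᵥ lincomb as vs

  LinIndep : ∀ {d} → Vec Vect d → Set (c ⊔ ℓ)
  LinIndep {d} vs = ∀ (cs : Vec Carrier d) → lincomb cs vs ≈ᵥ 0ᵥ → All (_≈ 0#) cs

  record Subspace : Set c where
    constructor span
    field
      {size} : ℕ
      gens   : Vec Vect size
  open Subspace public

  _∈_ : Vect → Subspace → Set (c ⊔ ℓ)
  v ∈ A = ∃ λ (cs : Vec Carrier (size A)) → v ≈ᵥ lincomb cs (gens A)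

  _⊆_ : Subspace → Subspace → Set (c ⊔ ℓ)
  A ⊆ B = ∀ v → v ∈ A → v ∈ B

  _≈ₛ_ : Subspace → Subspace → Set (c ⊔ ℓ)
  A ≈ₛ B = (A ⊆ B) × (B ⊆ A)

  _⊕_ : Subspace → Subspace → Subspace
  A ⊕ B = span (gens A ++ gens B)

  HasDim : Subspace → ℕ → Set (c ⊔ ℓ)
  HasDim A d = Σ (Vec Vect d) λ b → LinIndep b × (span b ≈ₛ A)

  CountIs : ∀ {a} → (Subspace → Set a) → ℕ → Set (c ⊔ ℓ ⊔ a)
  CountIs P N =
    Σ (Fin N → Subspace) λ L →
      (∀ i → P (L i)) ×
      (∀ i j → L i ≈ₛ L j → i ≡ j) ×
      (∀ A → P A → ∃ λ i → A ≈ₛ L i)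

_^ℚ_ : ℚ → ℕ → ℚ
x ^ℚ zero = 1ℚ
x ^ℚ suc m = x ℚ.* (x ^ℚ m)

-- q ↦ q^{-1} (the value at 0 is irrelevant: a field has q ≥ 2)
inv : ℕ → ℚ
inv zero = 0ℚ
inv (suc q) = + 1 ℚ./ suc q

poch : ℚ → ℕ → ℚ
poch x zero = 1ℚ
poch x (suc m) = poch x m ℚ.* (1ℚ ℚ.- (x ^ℚ suc m))

fromℕ : ℕ → ℚ
fromℕ k = + k ℚ./ 1

module Submission where

-- Write Z = U + W and fix bases u of U, z of Z and b of B.  An admissible A (dim A = l, U ⊆ A,
-- A + W = B) has a basis a ++ c ++ u in which c ++ u is a basis of A ∩ Z and a ++ z is a basis
-- of B, so |a| = m − k and |c| = k + l − j − m do not depend on A.  Conversely every pair (a, c)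
-- with c ⊆ Z extending u independently and a ⊆ B extending z independently spans an admissible A.
-- Counting these pairs all at once, and then those spanning a fixed A (c extends u inside A ∩ Z,
-- a extends c ++ u inside A), shows that N times the size of a fibre is the total.  Each count is
-- a number of independent extensions ∏ (q^s − q^t), and rewriting these as quotients of
-- q-Pochhammer symbols gives the formula.  Conditionally on Y = B, every admissible A is a single
-- outcome, so U⁺ is uniform on them.

open import Defs
open import Data.Nat using (ℕ; zero; suc)
import Data.Nat as ℕ

module ListCounting where
  open import Level using (Level)
  open import Data.Nat using (ℕ; zero; suc; _+_; _*_; _^_; _≤_; z≤n; s≤s)
  open import Data.Nat.Properties using (m≤n⇒m≤1+n; *-comm; +-suc; 1+n≢0)
  import Data.Fin as Fin
  open import Data.List.Base using (List; []; _∷_; [_]; length; map; filter; lookup;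
    cartesianProductWith; cartesianProduct; deduplicate; _++_)
  open import Data.List.Properties using (length-++; length-map; length-removeAt′)
  open import Data.List.Relation.Unary.All using (All; []; _∷_)
  open import Data.List.Relation.Unary.Any as Any using (Any; here; there; _─_)
  open import Data.List.Relation.Unary.AllPairs using ([]; _∷_)
  import Data.List.Relation.Unary.All as All
  import Data.List.Relation.Unary.All.Properties as AllP
  import Data.List.Relation.Unary.Any.Properties as AnyP
  open import Data.List.Membership.Propositional.Properties using (∈-lookup)
  open import Data.Product using (_×_; _,_; proj₁; proj₂)
  open import Data.Vec using (Vec; []; _∷_)
  open import Data.Vec.Relation.Binary.Pointwise.Inductive using ([]; _∷_)
  open import Function using (_∘_; _⇔_; mk⇔; Equivalence)
  open import Relation.Binary using (Setoid; DecSetoid)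
  open import Relation.Nullary using (¬_; yes; no; ¬?; contradiction)
  open import Relation.Nullary.Decidable using (_×-dec_)
  open import Relation.Unary using (Pred; Decidable)
  open import Relation.Binary.PropositionalEquality as ≡ using (_≡_; refl; cong; cong₂)
  open ≡.≡-Reasoning

  private variable a b p r : Level

  count : {A : Set a} {P : Pred A p} → Decidable P → List A → ℕ
  count P? xs = length (filter P? xs)

  module _ {A : Set a} {P : Pred A p} (P? : Decidable P) where

    count-complement : ∀ xs → count P? xs + count (¬? ∘ P?) xs ≡ length xs
    count-complement [] = refl
    count-complement (x ∷ xs) with P? x
    ... | yes _ = cong suc (count-complement xs)
    ... | no _ = ≡.trans (+-suc _ _) (cong suc (count-complement xs))

    count≡0⇒none : ∀ xs → count P? xs ≡ 0 → All (¬_ ∘ P) xs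
    count≡0⇒none [] _ = []
    count≡0⇒none (x ∷ xs) c≡0 with P? x
    ... | yes _ = contradiction c≡0 1+n≢0
    ... | no ¬px = ¬px ∷ count≡0⇒none xs c≡0

    count-++ : ∀ xs ys → count P? (xs ++ ys) ≡ count P? xs + count P? ys
    count-++ [] ys = refl
    count-++ (x ∷ xs) ys with P? x
    ... | yes _ = cong suc (count-++ xs ys)
    ... | no _ = count-++ xs ys

    count-none : ∀ {xs} → All (¬_ ∘ P) xs → count P? xs ≡ 0
    count-none [] = refl
    count-none {x ∷ _} (¬px ∷ ¬pxs) with P? x
    ... | yes px = contradiction px ¬px
    ... | no _ = count-none ¬pxs

  module _ {A : Set a} {P : Pred A p} {Q : Pred A r} (P? : Decidable P) (Q? : Decidable Q) where

    count-mono : (∀ {x} → P x → Q x) → ∀ xs → count P? xs ≤ count Q? xs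
    count-mono P⇒Q [] = z≤n
    count-mono P⇒Q (x ∷ xs) with P? x | Q? x
    ... | yes _ | yes _ = s≤s (count-mono P⇒Q xs)
    ... | yes px | no ¬qx = contradiction (P⇒Q px) ¬qx
    ... | no _ | yes _ = m≤n⇒m≤1+n (count-mono P⇒Q xs)
    ... | no _ | no _ = count-mono P⇒Q xs

    count-cong : ∀ {xs} → All (λ x → P x ⇔ Q x) xs → count P? xs ≡ count Q? xs
    count-cong [] = refl
    count-cong {x ∷ _} (P⇔Q ∷ eqs) with P? x | Q? x
    ... | yes _ | yes _ = cong suc (count-cong eqs)
    ... | yes px | no ¬qx = contradiction (Equivalence.to P⇔Q px) ¬qx
    ... | no ¬px | yes qx = contradiction (Equivalence.from P⇔Q qx) ¬px
    ... | no _ | no _ = count-cong eqs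

    count-filter : ∀ xs → count P? (filter Q? xs) ≡ count (λ x → P? x ×-dec Q? x) xs
    count-filter [] = refl
    count-filter (x ∷ xs) with Q? x
    ... | yes _ with P? x
    ...   | yes _ = cong suc (count-filter xs)
    ...   | no _ = count-filter xs
    count-filter (x ∷ xs) | no _ with P? x
    ...   | yes _ = count-filter xs
    ...   | no _ = count-filter xs

  module _ {A : Set a} {P : Pred A p} {Q : Pred A r} (P? : Decidable P) (Q? : Decidable Q) where

    count-filter-⇒ : (∀ {x} → P x → Q x) → ∀ xs → count P? (filter Q? xs) ≡ count P? xs
    count-filter-⇒ P⇒Q xs = ≡.trans (count-filter P? Q? xs)
      (count-cong (λ x → P? x ×-dec Q? x) P? (All.universal (λ x → mk⇔ proj₁ (λ px → px , P⇒Q px)) xs))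

  module _ {A : Set a} {B : Set b} {P : Pred B p} (P? : Decidable P) where

    count-map : (f : A → B) → ∀ xs → count P? (map f xs) ≡ count (P? ∘ f) xs
    count-map f [] = refl
    count-map f (x ∷ xs) with P? (f x)
    ... | yes _ = cong suc (count-map f xs)
    ... | no _ = count-map f xs

  module _ {A : Set a} {B : Set b} {C : Set r} {P : Pred C p} {Q : Pred A p}
           (P? : Decidable P) (Q? : Decidable Q) (f : A → B → C) (ys : List B) (c : ℕ) where

    count-cartesianProductWith :
      (∀ {x} → Q x → count (P? ∘ f x) ys ≡ c) → (∀ {x} → ¬ Q x → count (P? ∘ f x) ys ≡ 0) →
      ∀ xs → count P? (cartesianProductWith f xs ys) ≡ count Q? xs * c
    count-cartesianProductWith row-Q row-¬Q [] = refl
    count-cartesianProductWith row-Q row-¬Q (x ∷ xs) = begin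
      count P? (map (f x) ys ++ cartesianProductWith f xs ys)
        ≡⟨ count-++ P? (map (f x) ys) _ ⟩
      count P? (map (f x) ys) + count P? (cartesianProductWith f xs ys)
        ≡⟨ cong₂ _+_ (count-map P? (f x) ys) (count-cartesianProductWith row-Q row-¬Q xs) ⟩
      count (P? ∘ f x) ys + count Q? xs * c
        ≡⟨ row x ⟩
      count Q? (x ∷ xs) * c ∎
      where
      row : ∀ x → count (P? ∘ f x) ys + count Q? xs * c ≡ count Q? (x ∷ xs) * c
      row x with Q? x
      ... | yes qx = cong (_+ count Q? xs * c) (row-Q qx)
      ... | no ¬qx = cong (_+ count Q? xs * c) (row-¬Q ¬qx)

  module _ {A : Set a} {B : Set b} {P : Pred A p} {Q : Pred B p} (P? : Decidable P) (Q? : Decidable Q) where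

    count-cartesianProduct : ∀ xs ys →
      count (λ (x , y) → P? x ×-dec Q? y) (cartesianProduct xs ys) ≡ count P? xs * count Q? ys
    count-cartesianProduct xs ys = count-cartesianProductWith _ P? _,_ ys (count Q? ys)
      (λ px → count-cong _ Q? (All.universal (λ y → mk⇔ proj₂ (px ,_)) ys))
      (λ ¬px → count-none _ (All.universal (λ y (px , _) → ¬px px) ys)) xs

  length-cartesianProductWith : {A : Set a} {B : Set b} {C : Set r} (f : A → B → C) (xs : List A) (ys : List B) →
    length (cartesianProductWith f xs ys) ≡ length xs * length ys
  length-cartesianProductWith f [] ys = refl
  length-cartesianProductWith f (x ∷ xs) ys = begin
    length (map (f x) ys ++ cartesianProductWith f xs ys)
      ≡⟨ length-++ (map (f x) ys) ⟩
    length (map (f x) ys) + length (cartesianProductWith f xs ys)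
      ≡⟨ cong₂ _+_ (length-map (f x) ys) (length-cartesianProductWith f xs ys) ⟩
    length ys + length xs * length ys ∎

  module _ (S : Setoid a r) where
    open Setoid S renaming (Carrier to A) hiding (refl)
    open import Data.List.Membership.Setoid S using (_∈_)
    open import Data.List.Relation.Binary.Subset.Setoid S using (_⊆_)
    open import Data.List.Relation.Unary.Unique.Setoid S using (Unique)

    private
      ∈-─ : ∀ {x y ys} (x∈ys : x ∈ ys) → y ∈ ys → ¬ y ≈ x → y ∈ (ys ─ x∈ys)
      ∈-─ (here x≈z) (here y≈z) y≉x = contradiction (trans y≈z (sym x≈z)) y≉x
      ∈-─ (here _) (there y∈ys) _ = y∈ys
      ∈-─ (there _) (here y≈z) _ = here y≈z
      ∈-─ (there x∈ys) (there y∈ys) y≉x = there (∈-─ x∈ys y∈ys y≉x)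

    unique-⊆⇒length≤ : ∀ {xs ys} → Unique xs → xs ⊆ ys → length xs ≤ length ys
    unique-⊆⇒length≤ {[]} _ _ = z≤n
    unique-⊆⇒length≤ {x ∷ xs} {ys} (x≉xs ∷ !xs) x∷xs⊆ys =
      subst-≤ (s≤s (unique-⊆⇒length≤ !xs xs⊆ys─x))
      where
      x∈ys : x ∈ ys
      x∈ys = x∷xs⊆ys (here (Setoid.refl S))
      subst-≤ : suc (length xs) ≤ suc (length (ys ─ x∈ys)) → length (x ∷ xs) ≤ length ys
      subst-≤ le rewrite length-removeAt′ ys (Any.index x∈ys) = le
      ≉-resp : ∀ {w z} → w ≈ z → ¬ x ≈ w → ¬ x ≈ z
      ≉-resp w≈z x≉w x≈z = x≉w (trans x≈z (sym w≈z))
      xs⊆ys─x : xs ⊆ (ys ─ x∈ys)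
      xs⊆ys─x {y} y∈xs = ∈-─ x∈ys (x∷xs⊆ys (there y∈xs))
        (λ y≈x → All.lookupₛ S ≉-resp x≉xs y∈xs (sym y≈x))

    unique⇒lookup-injective : ∀ {xs} → Unique xs → ∀ i j → lookup xs i ≈ lookup xs j → i ≡ j
    unique⇒lookup-injective (_ ∷ _) Fin.zero Fin.zero _ = refl
    unique⇒lookup-injective {_ ∷ xs} (x≉xs ∷ _) Fin.zero (Fin.suc j) x≈ =
      contradiction x≈ (All.lookup x≉xs (∈-lookup j))
    unique⇒lookup-injective {_ ∷ xs} (x≉xs ∷ _) (Fin.suc i) Fin.zero ≈x =
      contradiction (sym ≈x) (All.lookup x≉xs (∈-lookup i))
    unique⇒lookup-injective (_ ∷ !xs) (Fin.suc i) (Fin.suc j) eq =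
      cong Fin.suc (unique⇒lookup-injective !xs i j eq)

  vectors : {A : Set a} → List A → (r : ℕ) → List (Vec A r)
  vectors xs zero = [ [] ]
  vectors xs (suc r) = cartesianProductWith (λ t x → x ∷ t) (vectors xs r) xs

  length-vectors : {A : Set a} (xs : List A) (r : ℕ) → length (vectors xs r) ≡ length xs ^ r
  length-vectors xs zero = refl
  length-vectors xs (suc r) = begin
    length (vectors xs (suc r)) ≡⟨ length-cartesianProductWith _ (vectors xs r) xs ⟩
    length (vectors xs r) * length xs ≡⟨ cong (_* length xs) (length-vectors xs r) ⟩
    length xs ^ r * length xs ≡⟨ *-comm (length xs ^ r) (length xs) ⟩
    length xs ^ suc r ∎

  module _ (S : Setoid a r) where
    open Setoid S renaming (Carrier to A)
    open import Data.List.Membership.Setoid S using (_∈_)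
    open import Data.Vec.Relation.Binary.Equality.Setoid S using (_≋_; ≋-setoid)
    import Data.List.Relation.Unary.Unique.Setoid as Unique
    import Data.List.Relation.Unary.Unique.Setoid.Properties as UniqueP

    vectors-complete : ∀ {xs} → (∀ x → x ∈ xs) → ∀ {r} (t : Vec A r) → Any (t ≋_) (vectors xs r)
    vectors-complete xs-complete [] = here []
    vectors-complete xs-complete (x ∷ t) =
      AnyP.cartesianProductWith⁺ _ (λ t≋ x≈ → x≈ ∷ t≋) (vectors-complete xs-complete t) (xs-complete x)

    vectors-unique : ∀ {xs} → Unique.Unique S xs → ∀ r → Unique.Unique (≋-setoid r) (vectors xs r)
    vectors-unique !xs zero = [] ∷ []
    vectors-unique !xs (suc r) = UniqueP.cartesianProductWith⁺ (≋-setoid r) S (≋-setoid (suc r)) _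
      (λ { (x≈y ∷ t≋u) → t≋u , x≈y }) (vectors-unique !xs r) !xs

  module _ (S : DecSetoid a r) where
    open DecSetoid S using (_≈_; _≟_; setoid; sym; trans) renaming (Carrier to A; refl to ≈-refl)
    open import Data.List.Relation.Unary.Unique.Setoid setoid using (Unique)
    open import Data.List.Relation.Unary.Unique.DecSetoid.Properties using (deduplicate-!)

    length-classes : ∀ {rs} xs f → Unique rs → All (λ x → Any (x ≈_) rs) xs →
      All (λ r → count (r ≟_) xs ≡ f) rs → length rs * f ≡ length xs
    length-classes {[]} [] f [] [] [] = refl
    length-classes {[]} (x ∷ xs) f [] (() ∷ _) []
    length-classes {r ∷ rs} xs f (r≉rs ∷ !rs) covered (class-r ∷ classes) = begin
      f + length rs * f
        ≡⟨ cong₂ _+_ (≡.sym class-r) (length-classes rest f !rs rest-covered rest-classes) ⟩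
      count (r ≟_) xs + length rest
        ≡⟨ count-complement (r ≟_) xs ⟩
      length xs ∎
      where
      rest : List A
      rest = filter (¬? ∘ (r ≟_)) xs
      rest-covered : All (λ x → Any (x ≈_) rs) rest
      rest-covered = All.zipWith drop-r (AllP.filter⁺ (¬? ∘ (r ≟_)) covered , AllP.all-filter (¬? ∘ (r ≟_)) xs)
        where
        drop-r : ∀ {x} → Any (x ≈_) (r ∷ rs) × ¬ r ≈ x → Any (x ≈_) rs
        drop-r (here x≈r , r≉x) = contradiction (sym x≈r) r≉x
        drop-r (there x∈rs , _) = x∈rs
      rest-classes : All (λ r′ → count (r′ ≟_) rest ≡ f) rs
      rest-classes = All.zipWith same-count (r≉rs , classes)
        where
        same-count : ∀ {r′} → ¬ r ≈ r′ × count (r′ ≟_) xs ≡ f → count (r′ ≟_) rest ≡ f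
        same-count {r′} (r≉r′ , class-r′) = begin
          count (r′ ≟_) rest ≡⟨ count-filter (r′ ≟_) (¬? ∘ (r ≟_)) xs ⟩
          count (λ y → (r′ ≟ y) ×-dec ¬? (r ≟ y)) xs
            ≡⟨ count-cong _ (r′ ≟_) (All.universal (λ _ → mk⇔ proj₁
                 (λ r′≈y → r′≈y , λ r≈y → r≉r′ (trans r≈y (sym r′≈y)))) xs) ⟩
          count (r′ ≟_) xs ≡⟨ class-r′ ⟩
          f ∎

    length-deduplicate-* : ∀ xs f → All (λ x → count (x ≟_) xs ≡ f) xs →
      length (deduplicate _≟_ xs) * f ≡ length xs
    length-deduplicate-* xs f classes = length-classes xs f (deduplicate-! S xs)
      (All.tabulate (λ x∈xs → AnyP.deduplicate⁺ _≟_ (λ z≈y x≈y → trans x≈y (sym z≈y))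
        (Any.map (λ { ≡.refl → ≈-refl }) x∈xs)))
      (AllP.deduplicate⁺ _≟_ classes)

module VectorArithmetic {c ℓ} (F : FiniteField c ℓ) where
  open import Level using (_⊔_)
  open import Data.Nat using (ℕ; zero; suc)
  open import Data.Vec using (Vec; []; _∷_)
  open import Data.Vec.Relation.Binary.Pointwise.Inductive using ([]; _∷_)
  open import Data.Product using (_,_)
  open import Algebra.Bundles using (AbelianGroup; CommutativeRing)
  open import Algebra.Structures using (IsAbelianGroup)
  open FiniteField F
  open import Algebra.Properties.Ring (CommutativeRing.ring cring) using (-1*x≈-x)
  open import Data.Vec.Relation.Binary.Equality.Setoid setoid using (≋-isEquivalence)
  private module Vectors {p : ℕ} = Linear F p
  open Vectors public using (_+ᵥ_; _·ᵥ_; 0ᵥ; _≈ᵥ_)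

  -- Negation as the scalar multiple by -1, so that spans are visibly closed under it.
  -ᵥ_ : ∀ {p} → Vec Carrier p → Vec Carrier p
  -ᵥ v = (- 1#) ·ᵥ v

  +ᵥ-cong : ∀ {p} {u u′ v v′ : Vec Carrier p} → u ≈ᵥ u′ → v ≈ᵥ v′ → (u +ᵥ v) ≈ᵥ (u′ +ᵥ v′)
  +ᵥ-cong [] [] = []
  +ᵥ-cong (x≈ ∷ u≈) (y≈ ∷ v≈) = +-cong x≈ y≈ ∷ +ᵥ-cong u≈ v≈

  ·ᵥ-cong : ∀ {p a a′} {v v′ : Vec Carrier p} → a ≈ a′ → v ≈ᵥ v′ → (a ·ᵥ v) ≈ᵥ (a′ ·ᵥ v′)
  ·ᵥ-cong a≈ [] = []
  ·ᵥ-cong a≈ (x≈ ∷ v≈) = *-cong a≈ x≈ ∷ ·ᵥ-cong a≈ v≈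

  +ᵥ-assoc : ∀ {p} (u v w : Vec Carrier p) → ((u +ᵥ v) +ᵥ w) ≈ᵥ (u +ᵥ (v +ᵥ w))
  +ᵥ-assoc [] [] [] = []
  +ᵥ-assoc (x ∷ u) (y ∷ v) (z ∷ w) = +-assoc x y z ∷ +ᵥ-assoc u v w

  +ᵥ-comm : ∀ {p} (u v : Vec Carrier p) → (u +ᵥ v) ≈ᵥ (v +ᵥ u)
  +ᵥ-comm [] [] = []
  +ᵥ-comm (x ∷ u) (y ∷ v) = +-comm x y ∷ +ᵥ-comm u v

  +ᵥ-identityˡ : ∀ {p} (v : Vec Carrier p) → (0ᵥ +ᵥ v) ≈ᵥ v
  +ᵥ-identityˡ [] = []
  +ᵥ-identityˡ (x ∷ v) = +-identityˡ x ∷ +ᵥ-identityˡ v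

  +ᵥ-identityʳ : ∀ {p} (v : Vec Carrier p) → (v +ᵥ 0ᵥ) ≈ᵥ v
  +ᵥ-identityʳ [] = []
  +ᵥ-identityʳ (x ∷ v) = +-identityʳ x ∷ +ᵥ-identityʳ v

  -ᵥ‿inverseˡ : ∀ {p} (v : Vec Carrier p) → ((-ᵥ v) +ᵥ v) ≈ᵥ 0ᵥ
  -ᵥ‿inverseˡ [] = []
  -ᵥ‿inverseˡ (x ∷ v) = trans (+-congʳ (-1*x≈-x x)) (-‿inverseˡ x) ∷ -ᵥ‿inverseˡ v

  -ᵥ‿inverseʳ : ∀ {p} (v : Vec Carrier p) → (v +ᵥ (-ᵥ v)) ≈ᵥ 0ᵥ
  -ᵥ‿inverseʳ [] = []
  -ᵥ‿inverseʳ (x ∷ v) = trans (+-congˡ (-1*x≈-x x)) (-‿inverseʳ x) ∷ -ᵥ‿inverseʳ v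

  ·ᵥ-distribˡ : ∀ {p} a (u v : Vec Carrier p) → (a ·ᵥ (u +ᵥ v)) ≈ᵥ ((a ·ᵥ u) +ᵥ (a ·ᵥ v))
  ·ᵥ-distribˡ a [] [] = []
  ·ᵥ-distribˡ a (x ∷ u) (y ∷ v) = distribˡ a x y ∷ ·ᵥ-distribˡ a u v

  ·ᵥ-distribʳ : ∀ {p} a b (v : Vec Carrier p) → ((a + b) ·ᵥ v) ≈ᵥ ((a ·ᵥ v) +ᵥ (b ·ᵥ v))
  ·ᵥ-distribʳ a b [] = []
  ·ᵥ-distribʳ a b (x ∷ v) = distribʳ x a b ∷ ·ᵥ-distribʳ a b v

  ·ᵥ-assoc : ∀ {p} a b (v : Vec Carrier p) → (a ·ᵥ (b ·ᵥ v)) ≈ᵥ ((a * b) ·ᵥ v)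
  ·ᵥ-assoc a b [] = []
  ·ᵥ-assoc a b (x ∷ v) = sym (*-assoc a b x) ∷ ·ᵥ-assoc a b v

  ·ᵥ-identityˡ : ∀ {p} (v : Vec Carrier p) → (1# ·ᵥ v) ≈ᵥ v
  ·ᵥ-identityˡ [] = []
  ·ᵥ-identityˡ (x ∷ v) = *-identityˡ x ∷ ·ᵥ-identityˡ v

  ·ᵥ-zeroˡ : ∀ {p} (v : Vec Carrier p) → (0# ·ᵥ v) ≈ᵥ 0ᵥ
  ·ᵥ-zeroˡ [] = []
  ·ᵥ-zeroˡ (x ∷ v) = zeroˡ x ∷ ·ᵥ-zeroˡ v

  ·ᵥ-zeroʳ : ∀ {p} a → (a ·ᵥ 0ᵥ {p}) ≈ᵥ 0ᵥ
  ·ᵥ-zeroʳ {zero} a = []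
  ·ᵥ-zeroʳ {suc p} a = zeroʳ a ∷ ·ᵥ-zeroʳ a

  +ᵥ-isAbelianGroup : ∀ p → IsAbelianGroup (_≈ᵥ_ {p}) _+ᵥ_ 0ᵥ -ᵥ_
  +ᵥ-isAbelianGroup p = record
    { isGroup = record
      { isMonoid = record
        { isSemigroup = record
          { isMagma = record { isEquivalence = ≋-isEquivalence p ; ∙-cong = +ᵥ-cong }
          ; assoc = +ᵥ-assoc }
        ; identity = +ᵥ-identityˡ , +ᵥ-identityʳ }
      ; inverse = -ᵥ‿inverseˡ , -ᵥ‿inverseʳ
      ; ⁻¹-cong = ·ᵥ-cong refl }
    ; comm = +ᵥ-comm }

  +ᵥ-abelianGroup : ℕ → AbelianGroup c (c ⊔ ℓ)
  +ᵥ-abelianGroup p = record { isAbelianGroup = +ᵥ-isAbelianGroup p }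

-- ∏_{t<r} (q^s − q^{t+i}): the number of ways to extend i independent vectors
-- by r further ones inside an s-dimensional space over a field with q elements.
extensionCount : (q s i r : ℕ) → ℕ
extensionCount q s i zero = 1
extensionCount q s i (suc r) = extensionCount q s i r ℕ.* (q ℕ.^ s ℕ.∸ q ℕ.^ (r ℕ.+ i))

module Subspaces {c ℓ} (F : FiniteField c ℓ) (n : ℕ) where
  open import Level using (_⊔_)
  open ListCounting
  open import Algebra.Bundles using (CommutativeRing)
  open import Data.Fin as Fin using (Fin)
  open import Data.Nat using (_^_; _∸_; _≤_; z≤n; s≤s)
  import Data.Nat.Properties as ℕₚ
  open import Data.Nat.Properties using (≤-antisym; ≤-trans; ≤-reflexive; ^-monoʳ-<; <⇒≱; ≤-<-connex)
  open import Data.Empty using (⊥-elim)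
  open import Data.Sum using (inj₁; inj₂)
  open import Data.List.Base as List using (List; tabulate; length; map; filter)
  open import Data.List.Properties using (length-map; length-tabulate)
  import Data.List.Membership.Setoid.Properties as ∈ₗ
  open import Data.List.Membership.Propositional.Properties using (∈-lookup)
  open import Data.List.Relation.Unary.Unique.Setoid using (Unique)
  open import Data.List.Relation.Unary.Any as ListAny using (Any; any?)
  import Data.List.Relation.Unary.Any.Properties as ListAnyP
  import Data.List.Relation.Unary.Unique.Setoid.Properties as UniqueP
  open import Data.Product using (∃; _×_; _,_; proj₁; proj₂; swap)
  open import Function using (_∘_; mk⇔)
  import Data.List.Relation.Unary.All as ListAll
  open import Data.Unit.Polymorphic using (⊤)
  open import Data.Vec using (Vec; []; _∷_; _++_; splitAt)
  open import Data.Vec.Relation.Binary.Pointwise.Inductive as Pointwise using (Pointwise; []; _∷_)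
  open import Data.Vec.Relation.Unary.All as All using (All; []; _∷_)
  import Data.Vec.Relation.Unary.All.Properties as AllP
  open import Relation.Binary using (Setoid; DecSetoid; IsEquivalence)
  import Relation.Binary.Reasoning.Setoid
  open import Relation.Binary.PropositionalEquality as ≡ using (_≡_)
  open import Relation.Nullary using (¬_; Dec; yes; no; contradiction)
  open import Relation.Nullary.Decidable using (_×-dec_; map′; ¬?)

  open FiniteField F
  open Linear F n hiding (_+ᵥ_; _·ᵥ_; 0ᵥ; _≈ᵥ_)
  open VectorArithmetic F
  open import Data.Vec.Relation.Binary.Equality.Setoid setoid using (≋-refl; ≋-sym; ≋-trans; ≋-setoid)
  module VectorGroup (p : ℕ) where
    open import Algebra.Bundles using (AbelianGroup)
    open import Algebra.Properties.AbelianGroup (+ᵥ-abelianGroup p) public using (xyx⁻¹≈y)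
    open import Algebra.Properties.CommutativeSemigroup
      (AbelianGroup.commutativeSemigroup (+ᵥ-abelianGroup p)) public using (interchange)
    open import Algebra.Properties.Group (AbelianGroup.group (+ᵥ-abelianGroup p)) public
      using (inverseˡ-unique; x≈y⇒x∙y⁻¹≈ε; x∙y⁻¹≈ε⇒x≈y)
  open VectorGroup n
  module ≈ᵥ-Reasoning = Relation.Binary.Reasoning.Setoid (≋-setoid n)

  lincomb-congˡ : ∀ {d} {cs ds : Vec Carrier d} (vs : Vec Vect d) → cs ≈ᵥ ds → lincomb cs vs ≈ᵥ lincomb ds vs
  lincomb-congˡ [] [] = ≋-refl
  lincomb-congˡ (v ∷ vs) (c≈ ∷ cs≈) = +ᵥ-cong (·ᵥ-cong c≈ ≋-refl) (lincomb-congˡ vs cs≈)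

  lincomb-congʳ : ∀ {d} (cs : Vec Carrier d) {vs ws : Vec Vect d} → Pointwise _≈ᵥ_ vs ws →
    lincomb cs vs ≈ᵥ lincomb cs ws
  lincomb-congʳ [] [] = ≋-refl
  lincomb-congʳ (c ∷ cs) (v≈ ∷ vs≈) = +ᵥ-cong (·ᵥ-cong refl v≈) (lincomb-congʳ cs vs≈)

  lincomb-+ : ∀ {d} (cs ds : Vec Carrier d) (vs : Vec Vect d) →
    lincomb (cs +ᵥ ds) vs ≈ᵥ (lincomb cs vs +ᵥ lincomb ds vs)
  lincomb-+ [] [] [] = ≋-sym (+ᵥ-identityˡ 0ᵥ)
  lincomb-+ (a ∷ cs) (b ∷ ds) (v ∷ vs) = begin
    ((a + b) ·ᵥ v) +ᵥ lincomb (cs +ᵥ ds) vs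
      ≈⟨ +ᵥ-cong (·ᵥ-distribʳ a b v) (lincomb-+ cs ds vs) ⟩
    ((a ·ᵥ v) +ᵥ (b ·ᵥ v)) +ᵥ (lincomb cs vs +ᵥ lincomb ds vs)
      ≈⟨ interchange (a ·ᵥ v) (b ·ᵥ v) _ _ ⟩
    ((a ·ᵥ v) +ᵥ lincomb cs vs) +ᵥ ((b ·ᵥ v) +ᵥ lincomb ds vs) ∎
    where open ≈ᵥ-Reasoning

  lincomb-· : ∀ {d} a (cs : Vec Carrier d) (vs : Vec Vect d) → lincomb (a ·ᵥ cs) vs ≈ᵥ (a ·ᵥ lincomb cs vs)
  lincomb-· a [] [] = ≋-sym (·ᵥ-zeroʳ a)
  lincomb-· a (b ∷ cs) (v ∷ vs) = begin
    ((a * b) ·ᵥ v) +ᵥ lincomb (a ·ᵥ cs) vs ≈⟨ +ᵥ-cong (≋-sym (·ᵥ-assoc a b v)) (lincomb-· a cs vs) ⟩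
    (a ·ᵥ (b ·ᵥ v)) +ᵥ (a ·ᵥ lincomb cs vs) ≈⟨ ≋-sym (·ᵥ-distribˡ a (b ·ᵥ v) _) ⟩
    a ·ᵥ ((b ·ᵥ v) +ᵥ lincomb cs vs) ∎
    where open ≈ᵥ-Reasoning

  lincomb-0 : ∀ {d} (vs : Vec Vect d) → lincomb 0ᵥ vs ≈ᵥ 0ᵥ
  lincomb-0 [] = ≋-refl
  lincomb-0 (v ∷ vs) = ≋-trans (+ᵥ-cong (·ᵥ-zeroˡ v) (lincomb-0 vs)) (+ᵥ-identityˡ 0ᵥ)

  lincomb-++ : ∀ {d e} (cs : Vec Carrier d) (ds : Vec Carrier e) (us : Vec Vect d) (vs : Vec Vect e) →
    lincomb (cs ++ ds) (us ++ vs) ≈ᵥ (lincomb cs us +ᵥ lincomb ds vs)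
  lincomb-++ [] ds [] vs = ≋-sym (+ᵥ-identityˡ _)
  lincomb-++ (c ∷ cs) ds (u ∷ us) vs =
    ≋-trans (+ᵥ-cong ≋-refl (lincomb-++ cs ds us vs)) (≋-sym (+ᵥ-assoc _ _ _))

  ∈-resp-≈ᵥ : ∀ {u v} (S : Subspace) → u ≈ᵥ v → u ∈ S → v ∈ S
  ∈-resp-≈ᵥ S u≈v (cs , u≈) = cs , ≋-trans (≋-sym u≈v) u≈

  0ᵥ-∈ : (S : Subspace) → 0ᵥ ∈ S
  0ᵥ-∈ S = 0ᵥ , ≋-sym (lincomb-0 (gens S))

  +ᵥ-∈ : ∀ {u v} (S : Subspace) → u ∈ S → v ∈ S → (u +ᵥ v) ∈ S
  +ᵥ-∈ S (cs , u≈) (ds , v≈) = cs +ᵥ ds , ≋-trans (+ᵥ-cong u≈ v≈) (≋-sym (lincomb-+ cs ds (gens S)))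

  ·ᵥ-∈ : ∀ {v} a (S : Subspace) → v ∈ S → (a ·ᵥ v) ∈ S
  ·ᵥ-∈ a S (cs , v≈) = a ·ᵥ cs , ≋-trans (·ᵥ-cong refl v≈) (≋-sym (lincomb-· a cs (gens S)))

  lincomb-∈ : ∀ {d} (S : Subspace) (cs : Vec Carrier d) {vs : Vec Vect d} → All (_∈ S) vs → lincomb cs vs ∈ S
  lincomb-∈ S [] [] = 0ᵥ-∈ S
  lincomb-∈ S (a ∷ cs) (v∈ ∷ vs∈) = +ᵥ-∈ S (·ᵥ-∈ a S v∈) (lincomb-∈ S cs vs∈)

  span-⊆ : ∀ {d} (S : Subspace) {vs : Vec Vect d} → All (_∈ S) vs → span vs ⊆ S
  span-⊆ S vs∈ v (cs , v≈) = ∈-resp-≈ᵥ S (≋-sym v≈) (lincomb-∈ S cs vs∈)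

  ∈-span-∷ : ∀ {d x} (v : Vect) (vs : Vec Vect d) → x ∈ span vs → x ∈ span (v ∷ vs)
  ∈-span-∷ v vs (cs , x≈) = 0# ∷ cs , ≋-trans x≈ (≋-sym (≋-trans (+ᵥ-cong (·ᵥ-zeroˡ v) ≋-refl) (+ᵥ-identityˡ _)))

  ∈-span-head : ∀ {d} (v : Vect) (vs : Vec Vect d) → v ∈ span (v ∷ vs)
  ∈-span-head v vs = 1# ∷ 0ᵥ , ≋-sym (≋-trans (+ᵥ-cong (·ᵥ-identityˡ v) (lincomb-0 vs)) (+ᵥ-identityʳ v))

  gens-∈-span : ∀ {d} (vs : Vec Vect d) → All (_∈ span vs) vs
  gens-∈-span [] = []
  gens-∈-span (v ∷ vs) = ∈-span-head v vs ∷ All.map (∈-span-∷ v vs) (gens-∈-span vs)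

  ∈-span-++ˡ : ∀ {d e v} (us : Vec Vect d) (vs : Vec Vect e) → v ∈ span us → v ∈ span (us ++ vs)
  ∈-span-++ˡ us vs (cs , v≈) = cs ++ 0ᵥ ,
    ≋-trans v≈ (≋-sym (≋-trans (lincomb-++ cs _ us vs) (≋-trans (+ᵥ-cong ≋-refl (lincomb-0 vs)) (+ᵥ-identityʳ _))))

  ∈-span-++ʳ : ∀ {d e v} (us : Vec Vect d) (vs : Vec Vect e) → v ∈ span vs → v ∈ span (us ++ vs)
  ∈-span-++ʳ {d} us vs (cs , v≈) = 0ᵥ ++ cs ,
    ≋-trans v≈ (≋-sym (≋-trans (lincomb-++ (0ᵥ {d}) cs us vs)
      (≋-trans (+ᵥ-cong (lincomb-0 us) ≋-refl) (+ᵥ-identityˡ _))))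

  ∈-span-++⁻ : ∀ {d e v} (us : Vec Vect d) (vs : Vec Vect e) → v ∈ span (us ++ vs) →
    ∃ λ u → ∃ λ w → u ∈ span us × w ∈ span vs × v ≈ᵥ (u +ᵥ w)
  ∈-span-++⁻ {d} us vs (cs , v≈) with splitAt d cs
  ... | as , bs , ≡.refl = lincomb as us , lincomb bs vs , (as , ≋-refl) , (bs , ≋-refl) ,
    ≋-trans v≈ (lincomb-++ as bs us vs)

  span-++-monoʳ : ∀ {d e e′} (us : Vec Vect d) {vs : Vec Vect e} {ws : Vec Vect e′} →
    span vs ⊆ span ws → span (us ++ vs) ⊆ span (us ++ ws)
  span-++-monoʳ us {vs} {ws} vs⊆ws = span-⊆ _ (AllP.++⁺
    (All.map (∈-span-++ˡ us ws) (gens-∈-span us))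
    (All.map (λ v∈ → ∈-span-++ʳ us ws (vs⊆ws _ v∈)) (gens-∈-span vs)))

  span-resp-≈ᵥ : ∀ {d} {vs ws : Vec Vect d} → Pointwise _≈ᵥ_ vs ws → span vs ⊆ span ws
  span-resp-≈ᵥ vs≈ws v (cs , v≈) = cs , ≋-trans v≈ (lincomb-congʳ cs vs≈ws)

  ⊆-refl : {S : Subspace} → S ⊆ S
  ⊆-refl v v∈ = v∈

  ⊆-trans : {S T R : Subspace} → S ⊆ T → T ⊆ R → S ⊆ R
  ⊆-trans S⊆T T⊆R v v∈ = T⊆R v (S⊆T v v∈)

  ≈ₛ-isEquivalence : IsEquivalence _≈ₛ_
  ≈ₛ-isEquivalence = record
    { refl = ⊆-refl , ⊆-refl
    ; sym = λ (S⊆T , T⊆S) → T⊆S , S⊆T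
    ; trans = λ (S⊆T , T⊆S) (T⊆R , R⊆T) → ⊆-trans S⊆T T⊆R , ⊆-trans R⊆T T⊆S }

  ⊆-⊕ˡ : (S T : Subspace) → S ⊆ (S ⊕ T)
  ⊆-⊕ˡ S T v = ∈-span-++ˡ (gens S) (gens T)

  ⊆-⊕ʳ : (S T : Subspace) → T ⊆ (S ⊕ T)
  ⊆-⊕ʳ S T v = ∈-span-++ʳ (gens S) (gens T)

  ⊕-least : {S T R : Subspace} → S ⊆ R → T ⊆ R → (S ⊕ T) ⊆ R
  ⊕-least {S} {T} {R} S⊆R T⊆R v v∈ with ∈-span-++⁻ (gens S) (gens T) v∈
  ... | s , t , s∈ , t∈ , v≈ = ∈-resp-≈ᵥ R (≋-sym v≈) (+ᵥ-∈ R (S⊆R s s∈) (T⊆R t t∈))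

  ⊕-monoˡ : {S S′ : Subspace} (T : Subspace) → S ⊆ S′ → (S ⊕ T) ⊆ (S′ ⊕ T)
  ⊕-monoˡ {S′ = S′} T S⊆S′ = ⊕-least (⊆-trans S⊆S′ (⊆-⊕ˡ S′ T)) (⊆-⊕ʳ S′ T)

  -- Deciding membership by enumeration

  infix 4 _≟_
  _≟_ : (x y : Carrier) → Dec (x ≈ y)
  x ≟ y with complete x | complete y
  ... | i , x≈i | j , y≈j = map′
    (λ { ≡.refl → trans x≈i (sym y≈j) })
    (λ x≈y → distinct i j (trans (sym x≈i) (trans x≈y y≈j)))
    (i Fin.≟ j)

  scalars : List Carrier
  scalars = tabulate enum

  scalars-complete : ∀ x → Any (x ≈_) scalars
  scalars-complete x = ListAnyP.tabulate⁺ (proj₁ (complete x)) (proj₂ (complete x))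

  scalars-unique : Unique setoid scalars
  scalars-unique = UniqueP.tabulate⁺ setoid (λ {i} {j} → distinct i j)

  allVectors : List Vect
  allVectors = vectors scalars n

  allVectors-complete : ∀ v → Any (v ≈ᵥ_) allVectors
  allVectors-complete = vectors-complete setoid scalars-complete

  infix 4 _∈?_
  _∈?_ : (v : Vect) (S : Subspace) → Dec (v ∈ S)
  v ∈? S = map′
    (λ ∈coefficients → ListAny.lookup ∈coefficients , ListAnyP.lookup-result ∈coefficients)
    (λ (cs , v≈) → ListAny.map (λ cs≋ → ≋-trans v≈ (lincomb-congˡ (gens S) cs≋))
      (vectors-complete setoid scalars-complete cs))
    (any? (λ cs → Pointwise.decidable _≟_ v (lincomb cs (gens S))) (vectors scalars (size S)))

  infix 4 _⊆?_ _≈ₛ?_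
  _⊆?_ : (S T : Subspace) → Dec (S ⊆ T)
  S ⊆? T = map′ (span-⊆ T) (λ S⊆T → All.map (S⊆T _) (gens-∈-span (gens S))) (All.all? (_∈? T) (gens S))

  _≈ₛ?_ : (S T : Subspace) → Dec (S ≈ₛ T)
  S ≈ₛ? T = (S ⊆? T) ×-dec (T ⊆? S)

  subspaceDecSetoid : DecSetoid c (c ⊔ ℓ)
  subspaceDecSetoid = record
    { isDecEquivalence = record { isEquivalence = ≈ₛ-isEquivalence ; _≟_ = _≈ₛ?_ } }

  -- Equivalent to LinIndep, but decidable and extended one vector at a time.
  Independent : ∀ {d} → Vec Vect d → Set (c ⊔ ℓ)
  Independent [] = ⊤
  Independent (v ∷ vs) = Independent vs × ¬ (v ∈ span vs)

  independent? : ∀ {d} (vs : Vec Vect d) → Dec (Independent vs)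
  independent? [] = yes _
  independent? (v ∷ vs) = independent? vs ×-dec ¬? (v ∈? span vs)

  -1≉0 : ¬ (- 1#) ≈ 0#
  -1≉0 -1≈0 = IsField.0≉1 isField (trans (sym -0#≈0#) (trans (-‿cong (sym -1≈0)) (-‿involutive 1#)))
    where open import Algebra.Properties.Ring (CommutativeRing.ring cring) using (-‿involutive; -0#≈0#)

  Independent⇒LinIndep : ∀ {d} (vs : Vec Vect d) → Independent vs → LinIndep vs
  Independent⇒LinIndep [] _ [] _ = []
  Independent⇒LinIndep (v ∷ vs) (indep , v∉) (a ∷ cs) a·v+lc≈0 with a ≟ 0#
  ... | yes a≈0 = a≈0 ∷ Independent⇒LinIndep vs indep cs (begin
        lincomb cs vs ≈⟨ ≋-sym (+ᵥ-identityˡ _) ⟩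
        0ᵥ +ᵥ lincomb cs vs ≈⟨ +ᵥ-cong (≋-sym (≋-trans (·ᵥ-cong a≈0 ≋-refl) (·ᵥ-zeroˡ v))) ≋-refl ⟩
        (a ·ᵥ v) +ᵥ lincomb cs vs ≈⟨ a·v+lc≈0 ⟩
        0ᵥ ∎)
    where open ≈ᵥ-Reasoning
  ... | no a≉0 = contradiction v∈vs v∉
    where
    open ≈ᵥ-Reasoning
    a⁻¹ : Carrier
    a⁻¹ = proj₁ (IsField.inverse isField a a≉0)
    v≈ : v ≈ᵥ (a⁻¹ ·ᵥ (-ᵥ lincomb cs vs))
    v≈ = begin
      v ≈⟨ ≋-sym (·ᵥ-identityˡ v) ⟩
      1# ·ᵥ v ≈⟨ ·ᵥ-cong (sym (trans (*-comm a⁻¹ a) (proj₂ (IsField.inverse isField a a≉0)))) ≋-refl ⟩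
      (a⁻¹ * a) ·ᵥ v ≈⟨ ≋-sym (·ᵥ-assoc a⁻¹ a v) ⟩
      a⁻¹ ·ᵥ (a ·ᵥ v) ≈⟨ ·ᵥ-cong refl (inverseˡ-unique _ _ a·v+lc≈0) ⟩
      a⁻¹ ·ᵥ (-ᵥ lincomb cs vs) ∎
    v∈vs : v ∈ span vs
    v∈vs = ∈-resp-≈ᵥ (span vs) (≋-sym v≈) (·ᵥ-∈ a⁻¹ (span vs) (·ᵥ-∈ (- 1#) (span vs) (cs , ≋-refl)))

  LinIndep⇒Independent : ∀ {d} (vs : Vec Vect d) → LinIndep vs → Independent vs
  LinIndep⇒Independent [] _ = _
  LinIndep⇒Independent (v ∷ vs) indep = LinIndep⇒Independent vs indep-vs , v∉
    where
    indep-vs : LinIndep vs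
    indep-vs cs lc≈0 = All.tail (indep (0# ∷ cs) (≋-trans (+ᵥ-cong (·ᵥ-zeroˡ v) lc≈0) (+ᵥ-identityˡ 0ᵥ)))
    v∉ : ¬ (v ∈ span vs)
    v∉ (cs , v≈) = -1≉0 (All.head (indep (- 1# ∷ cs)
      (≋-trans (+ᵥ-cong ≋-refl (≋-sym v≈)) (≋-trans (+ᵥ-comm _ _) (-ᵥ‿inverseʳ v)))))

  lincomb-injective : ∀ {d} (vs : Vec Vect d) → Independent vs →
    ∀ {cs ds} → lincomb cs vs ≈ᵥ lincomb ds vs → cs ≈ᵥ ds
  lincomb-injective {d} vs indep {cs} {ds} lc≈lc = VectorGroup.x∙y⁻¹≈ε⇒x≈y d cs ds (All-≈0⇒≈0ᵥ
    (Independent⇒LinIndep vs indep (cs +ᵥ (-ᵥ ds)) (begin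
      lincomb (cs +ᵥ (-ᵥ ds)) vs ≈⟨ lincomb-+ cs (-ᵥ ds) vs ⟩
      lincomb cs vs +ᵥ lincomb (-ᵥ ds) vs ≈⟨ +ᵥ-cong ≋-refl (lincomb-· (- 1#) ds vs) ⟩
      lincomb cs vs +ᵥ (-ᵥ lincomb ds vs) ≈⟨ x≈y⇒x∙y⁻¹≈ε lc≈lc ⟩
      0ᵥ ∎)))
    where
    open ≈ᵥ-Reasoning
    All-≈0⇒≈0ᵥ : ∀ {p} {xs : Vec Carrier p} → All (_≈ 0#) xs → xs ≈ᵥ 0ᵥ
    All-≈0⇒≈0ᵥ [] = []
    All-≈0⇒≈0ᵥ (x≈0 ∷ xs≈0) = x≈0 ∷ All-≈0⇒≈0ᵥ xs≈0

  independent-resp-≈ᵥ : ∀ {d} {vs ws : Vec Vect d} → Pointwise _≈ᵥ_ vs ws → Independent vs → Independent ws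
  independent-resp-≈ᵥ {vs = vs} {ws} vs≈ws indep = LinIndep⇒Independent ws
    (λ cs lc≈0 → Independent⇒LinIndep vs indep cs (≋-trans (lincomb-congʳ cs vs≈ws) lc≈0))

  -- Cardinalities of subspaces

  q≥2 : 2 ≤ q
  q≥2 = atLeastTwo enum complete
    where
    atLeastTwo : ∀ {m} (e : Fin m → Carrier) → (∀ x → ∃ λ i → x ≈ e i) → 2 ≤ m
    atLeastTwo {zero} e onto with onto 0#
    ... | () , _
    atLeastTwo {suc zero} e onto with onto 0# | onto 1#
    ... | Fin.zero , 0≈ | Fin.zero , 1≈ = ⊥-elim (IsField.0≉1 isField (trans 0≈ (sym 1≈)))
    atLeastTwo {suc (suc m)} e onto = s≤s (s≤s z≤n)

  ∣_∣ : Subspace → ℕ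
  ∣ S ∣ = count (_∈? S) allVectors

  -- cs ↦ lincomb cs vs maps the q^d coefficient vectors injectively onto span vs;
  -- the pigeonhole principle, applied both ways, compares the two duplicate-free lists.
  ∣span∣≡q^ : ∀ {d} (vs : Vec Vect d) → Independent vs → ∣ span vs ∣ ≡ q ^ d
  ∣span∣≡q^ {d} vs indep = ≤-antisym
    (≤-trans (unique-⊆⇒length≤ (≋-setoid n) members-unique members⊆combinations)
      (≤-reflexive length-combinations))
    (≤-trans (≤-reflexive (≡.sym length-combinations))
      (unique-⊆⇒length≤ (≋-setoid n) combinations-unique combinations⊆members))
    where
    members combinations : List Vect
    members = filter (_∈? span vs) allVectors
    combinations = map (λ cs → lincomb cs vs) (vectors scalars d)
    length-combinations : length combinations ≡ q ^ d
    length-combinations = ≡.trans (length-map _ (vectors scalars d))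
      (≡.trans (length-vectors scalars d) (≡.cong (_^ d) (length-tabulate enum)))
    members-unique : Unique (≋-setoid n) members
    members-unique = UniqueP.filter⁺ (≋-setoid n) (_∈? span vs) {allVectors}
      (vectors-unique setoid scalars-unique n)
    combinations-unique : Unique (≋-setoid n) combinations
    combinations-unique = UniqueP.map⁺ (≋-setoid d) (≋-setoid n) (lincomb-injective vs indep)
      (vectors-unique setoid scalars-unique d)
    members⊆combinations : ∀ {x} → Any (x ≈ᵥ_) members → Any (x ≈ᵥ_) combinations
    members⊆combinations x∈
      with ∈ₗ.∈-filter⁻ (≋-setoid n) (_∈? span vs) (∈-resp-≈ᵥ (span vs)) {xs = allVectors} x∈
    ... | _ , (cs , x≈) = ∈ₗ.∈-resp-≈ (≋-setoid n) (≋-sym x≈)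
      (∈ₗ.∈-map⁺ (≋-setoid d) (≋-setoid n) (lincomb-congˡ vs) (vectors-complete setoid scalars-complete cs))
    combinations⊆members : ∀ {x} → Any (x ≈ᵥ_) combinations → Any (x ≈ᵥ_) members
    combinations⊆members {x} x∈ with ∈ₗ.∈-map⁻ (≋-setoid d) (≋-setoid n) x∈
    ... | cs , _ , x≈ = ∈ₗ.∈-filter⁺ (≋-setoid n) (_∈? span vs) (∈-resp-≈ᵥ (span vs))
      (allVectors-complete x) (cs , x≈)

  ∣∣-mono : {S T : Subspace} → S ⊆ T → ∣ S ∣ ≤ ∣ T ∣
  ∣∣-mono {S} {T} S⊆T = count-mono (_∈? S) (_∈? T) (S⊆T _) allVectors

  dim-mono : ∀ {d e} {vs : Vec Vect d} {ws : Vec Vect e} → Independent vs → Independent ws →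
    span vs ⊆ span ws → d ≤ e
  dim-mono {d} {e} {vs} {ws} indep-vs indep-ws vs⊆ws with ≤-<-connex d e
  ... | inj₁ d≤e = d≤e
  ... | inj₂ e<d = contradiction
    (≤-trans (≤-reflexive (≡.sym (∣span∣≡q^ vs indep-vs)))
      (≤-trans (∣∣-mono vs⊆ws) (≤-reflexive (∣span∣≡q^ ws indep-ws))))
    (<⇒≱ (^-monoʳ-< q q≥2 e<d))

  ∣_∖_∣ : Subspace → Subspace → ℕ
  ∣ S ∖ T ∣ = count (λ v → (v ∈? S) ×-dec ¬? (v ∈? T)) allVectors

  ∣∖∣+∣∣≡∣∣ : {S T : Subspace} → T ⊆ S → ∣ S ∖ T ∣ ℕ.+ ∣ T ∣ ≡ ∣ S ∣
  ∣∖∣+∣∣≡∣∣ {S} {T} T⊆S = begin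
    ∣ S ∖ T ∣ ℕ.+ ∣ T ∣ ≡⟨ ℕₚ.+-comm ∣ S ∖ T ∣ ∣ T ∣ ⟩
    ∣ T ∣ ℕ.+ ∣ S ∖ T ∣ ≡⟨ ≡.cong₂ ℕ._+_ T-inside-S S∖T-inside-S ⟩
    count (_∈? T) inS ℕ.+ count (¬? ∘ (_∈? T)) inS ≡⟨ count-complement (_∈? T) inS ⟩
    ∣ S ∣ ∎
    where
    open ≡.≡-Reasoning
    inS : List Vect
    inS = filter (_∈? S) allVectors
    T-inside-S : ∣ T ∣ ≡ count (_∈? T) inS
    T-inside-S = ≡.sym (≡.trans (count-filter (_∈? T) (_∈? S) allVectors)
      (count-cong _ (_∈? T) (ListAll.universal (λ v → mk⇔ proj₁ (λ v∈T → v∈T , T⊆S v v∈T)) allVectors)))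
    S∖T-inside-S : ∣ S ∖ T ∣ ≡ count (¬? ∘ (_∈? T)) inS
    S∖T-inside-S = ≡.sym (≡.trans (count-filter (¬? ∘ (_∈? T)) (_∈? S) allVectors)
      (count-cong _ _ (ListAll.universal (λ v → mk⇔ swap swap) allVectors)))

  ∣∖∣≡∣∣∸∣∣ : {S T : Subspace} → T ⊆ S → ∣ S ∖ T ∣ ≡ ∣ S ∣ ∸ ∣ T ∣
  ∣∖∣≡∣∣∸∣∣ {S} {T} T⊆S = ≡.trans (≡.sym (ℕₚ.m+n∸n≡m ∣ S ∖ T ∣ ∣ T ∣)) (≡.cong (_∸ ∣ T ∣) (∣∖∣+∣∣≡∣∣ T⊆S))

  dim-≡⇒⊇ : ∀ {d e} {vs : Vec Vect d} {ws : Vec Vect e} → d ≡ e → Independent vs → Independent ws →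
    span vs ⊆ span ws → span ws ⊆ span vs
  dim-≡⇒⊇ {d} {vs = vs} {ws} ≡.refl indep-vs indep-ws vs⊆ws v v∈ws with v ∈? span vs
  ... | yes v∈vs = v∈vs
  ... | no v∉vs = ⊥-elim (ListAll.lookupWith (λ ¬new v≈w → ¬new (∈-resp-≈ᵥ (span ws) v≈w v∈ws ,
                                        λ w∈vs → v∉vs (∈-resp-≈ᵥ (span vs) (≋-sym v≈w) w∈vs)))
    (count≡0⇒none _ allVectors nothing-new) (allVectors-complete v))
    where
    nothing-new : ∣ span ws ∖ span vs ∣ ≡ 0
    nothing-new = begin
      ∣ span ws ∖ span vs ∣ ≡⟨ ∣∖∣≡∣∣∸∣∣ vs⊆ws ⟩
      ∣ span ws ∣ ∸ ∣ span vs ∣ ≡⟨ ≡.cong₂ _∸_ (∣span∣≡q^ ws indep-ws) (∣span∣≡q^ vs indep-vs) ⟩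
      q ^ d ∸ q ^ d ≡⟨ ℕₚ.n∸n≡0 (q ^ d) ⟩
      0 ∎
      where open ≡.≡-Reasoning

  -- Extending independent families

  Extends : ∀ {s i r} → Vec Vect s → Vec Vect i → Vec Vect r → Set (c ⊔ ℓ)
  Extends g h t = All (_∈ span g) t × Independent (t ++ h)

  extends? : ∀ {s i r} (g : Vec Vect s) (h : Vec Vect i) (t : Vec Vect r) → Dec (Extends g h t)
  extends? g h t = All.all? (_∈? span g) t ×-dec independent? (t ++ h)

  extends-resp-≈ᵥ : ∀ {s i r} {g : Vec Vect s} {h : Vec Vect i} {t t′ : Vec Vect r} →
    Pointwise _≈ᵥ_ t t′ → Extends g h t → Extends g h t′
  extends-resp-≈ᵥ {g = g} t≈t′ (t⊆g , indep) =
    ∈-resp t≈t′ t⊆g , independent-resp-≈ᵥ (Pointwise.++⁺ t≈t′ (Pointwise.refl ≋-refl)) indep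
    where
    ∈-resp : ∀ {r} {t t′ : Vec Vect r} → Pointwise _≈ᵥ_ t t′ → All (_∈ span g) t → All (_∈ span g) t′
    ∈-resp [] [] = []
    ∈-resp (v≈ ∷ t≈) (v∈ ∷ t∈) = ∈-resp-≈ᵥ (span g) v≈ v∈ ∷ ∈-resp t≈ t∈

  count-extensions : ∀ {s i} {g : Vec Vect s} {h : Vec Vect i} → Independent g → Independent h →
    All (_∈ span g) h → ∀ r → count (extends? g h) (vectors allVectors r) ≡ extensionCount q s i r
  count-extensions {h = h} _ indep-h _ zero with independent? h
  ... | yes _ = ≡.refl
  ... | no ¬indep = contradiction indep-h ¬indep
  count-extensions {s} {i} {g} {h} indep-g indep-h h⊆g (suc r) = ≡.trans
    (count-cartesianProductWith (extends? g h) (extends? g h) (λ t x → x ∷ t) allVectors _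
      row-extends row-¬extends (vectors allVectors r))
    (≡.cong (ℕ._* _) (count-extensions indep-g indep-h h⊆g r))
    where
    open ≡.≡-Reasoning
    row-extends : ∀ {t} → Extends g h t →
      count (λ x → extends? g h (x ∷ t)) allVectors ≡ q ^ s ∸ q ^ (r ℕ.+ i)
    row-extends {t} (t⊆g , indep-t) = begin
      count (λ x → extends? g h (x ∷ t)) allVectors
        ≡⟨ count-cong _ _ (ListAll.universal (λ x → mk⇔ (λ (x∷t⊆g , (_ , x∉)) → All.head x∷t⊆g , x∉)
                                                    (λ (x∈g , x∉) → (x∈g ∷ t⊆g) , (indep-t , x∉))) allVectors) ⟩
      ∣ span g ∖ span (t ++ h) ∣
        ≡⟨ ∣∖∣≡∣∣∸∣∣ (span-⊆ (span g) (AllP.++⁺ t⊆g h⊆g)) ⟩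
      ∣ span g ∣ ∸ ∣ span (t ++ h) ∣
        ≡⟨ ≡.cong₂ _∸_ (∣span∣≡q^ g indep-g) (∣span∣≡q^ (t ++ h) indep-t) ⟩
      q ^ s ∸ q ^ (r ℕ.+ i) ∎
    row-¬extends : ∀ {t} → ¬ Extends g h t → count (λ x → extends? g h (x ∷ t)) allVectors ≡ 0
    row-¬extends ¬ext = count-none _
      (ListAll.universal (λ x (x∷t⊆g , (indep-t , _)) → ¬ext (All.tail x∷t⊆g , indep-t)) allVectors)

  module _ {p} {P : Vect → Set p} (P? : ∀ v → Dec (P v)) (P-resp : ∀ {v w} → v ≈ᵥ w → P v → P w)
           {i} (h : Vec Vect i) where

    record Completion : Set (c ⊔ ℓ ⊔ p) where
      field
        {added} : ℕ
        extra : Vec Vect added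
        independent : Independent (extra ++ h)
        within : All P extra
        spans : ∀ w → P w → w ∈ span (extra ++ h)

    private
      record Greedy {r} (t : Vec Vect r) (ws : List Vect) : Set (c ⊔ ℓ ⊔ p) where
        field
          {added} : ℕ
          extra : Vec Vect added
          independent : Independent (extra ++ h)
          within : All P extra
          grows : span (t ++ h) ⊆ span (extra ++ h)
          covers : ListAll.All (λ w → P w → w ∈ span (extra ++ h)) ws

      cons : ∀ {r r′ w ws} {t : Vec Vect r} {t′ : Vec Vect r′} → span (t ++ h) ⊆ span (t′ ++ h) →
        (rest : Greedy t′ ws) → (P w → w ∈ span (Greedy.extra rest ++ h)) → Greedy t (w List.∷ ws)
      cons t⊆t′ rest covers-w = record
        { extra = extra ; independent = independent ; within = within
        ; grows = ⊆-trans t⊆t′ grows ; covers = covers-w ListAll.∷ covers }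
        where open Greedy rest

      greedy : ∀ ws {r} (t : Vec Vect r) → Independent (t ++ h) → All P t → Greedy t ws
      greedy List.[] t indep t⊆P = record
        { extra = t ; independent = indep ; within = t⊆P ; grows = ⊆-refl ; covers = ListAll.[] }
      greedy (w List.∷ ws) t indep t⊆P with P? w | w ∈? span (t ++ h)
      ... | yes pw | no w∉ = cons (λ v → ∈-span-∷ w _) rest (λ _ → Greedy.grows rest w (∈-span-head w _))
        where
        rest : Greedy (w ∷ t) ws
        rest = greedy ws (w ∷ t) (indep , w∉) (pw ∷ t⊆P)
      ... | yes _ | yes w∈ = cons ⊆-refl rest (λ _ → Greedy.grows rest w w∈)
        where
        rest : Greedy t ws
        rest = greedy ws t indep t⊆P
      ... | no ¬pw | _ = cons ⊆-refl (greedy ws t indep t⊆P) (λ pw → contradiction pw ¬pw)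

    greedyCompletion : Independent h → Completion
    greedyCompletion indep-h = record
      { extra = extra ; independent = independent ; within = within ; spans = spans }
      where
      open Greedy (greedy allVectors [] indep-h [])
      spans : ∀ w → P w → w ∈ span (extra ++ h)
      spans w pw = ListAll.lookupWith
        (λ covered w≈v → ∈-resp-≈ᵥ (span (extra ++ h)) (≋-sym w≈v) (covered (P-resp w≈v pw)))
        covers (allVectors-complete w)

  independent-++-⊆ʳ : ∀ {d e e′} (a : Vec Vect d) {g : Vec Vect e} {z : Vec Vect e′} →
    Independent g → span g ⊆ span z → Independent (a ++ z) → Independent (a ++ g)
  independent-++-⊆ʳ [] indep-g _ _ = indep-g
  independent-++-⊆ʳ (v ∷ a) indep-g g⊆z (indep , v∉) =
    independent-++-⊆ʳ a indep-g g⊆z indep , λ v∈ → v∉ (span-++-monoʳ a g⊆z v v∈)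

  -- If v ∈ A lay in span (a ++ z), its component in span z would lie in A ∩ span z ⊆ span g.
  independent-++-⊇ʳ : ∀ {d e e′} (A : Subspace) {a : Vec Vect d} {g : Vec Vect e} {z : Vec Vect e′} →
    Independent z → All (_∈ A) a → (∀ x → x ∈ A → x ∈ span z → x ∈ span g) →
    Independent (a ++ g) → Independent (a ++ z)
  independent-++-⊇ʳ A {[]} indep-z _ _ _ = indep-z
  independent-++-⊇ʳ A {v ∷ a} {g} {z} indep-z (v∈A ∷ a⊆A) A∩z⊆g (indep , v∉) =
    independent-++-⊇ʳ A indep-z a⊆A A∩z⊆g indep , v∉a++z
    where
    v∉a++z : ¬ (v ∈ span (a ++ z))
    v∉a++z v∈ with ∈-span-++⁻ a z v∈
    ... | y , ζ , y∈a , ζ∈z , v≈y+ζ = v∉ (∈-resp-≈ᵥ (span (a ++ g)) (≋-sym v≈y+ζ)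
      (+ᵥ-∈ (span (a ++ g)) (∈-span-++ˡ a g y∈a) (∈-span-++ʳ a g (A∩z⊆g ζ ζ∈A ζ∈z))))
      where
      ζ∈A : ζ ∈ A
      ζ∈A = ∈-resp-≈ᵥ A (≋-trans (+ᵥ-cong v≈y+ζ ≋-refl) (xyx⁻¹≈y y ζ))
        (+ᵥ-∈ A v∈A (·ᵥ-∈ (- 1#) A (span-⊆ A a⊆A y y∈a)))

  span-++-disjoint : ∀ {d e} (a : Vec Vect d) (z : Vec Vect e) → Independent (a ++ z) →
    ∀ {y} → y ∈ span a → y ∈ span z → y ≈ᵥ 0ᵥ
  span-++-disjoint a z indep {y} (α , y≈α) (β , y≈β) =
    ≋-trans y≈α (≋-trans (lincomb-congˡ a α≈0) (lincomb-0 a))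
    where
    y-from-a : lincomb (α ++ 0ᵥ) (a ++ z) ≈ᵥ y
    y-from-a = ≋-trans (lincomb-++ α 0ᵥ a z) (≋-trans (+ᵥ-cong (≋-sym y≈α) (lincomb-0 z)) (+ᵥ-identityʳ y))
    y-from-z : lincomb (0ᵥ ++ β) (a ++ z) ≈ᵥ y
    y-from-z = ≋-trans (lincomb-++ 0ᵥ β a z) (≋-trans (+ᵥ-cong (lincomb-0 a) (≋-sym y≈β)) (+ᵥ-identityˡ y))
    α≈0 : α ≈ᵥ 0ᵥ
    α≈0 = Pointwise.++ˡ⁻ α 0ᵥ (lincomb-injective (a ++ z) indep (≋-trans y-from-a (≋-sym y-from-z)))

  span-++-∩ : ∀ {d e e′} (a : Vec Vect d) {g : Vec Vect e} {z : Vec Vect e′} → Independent (a ++ z) →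
    All (_∈ span z) g → ∀ x → x ∈ span (a ++ g) → x ∈ span z → x ∈ span g
  span-++-∩ a {g} {z} indep g⊆z x x∈ x∈z with ∈-span-++⁻ a g x∈
  ... | y , w , y∈a , w∈g , x≈y+w = ∈-resp-≈ᵥ (span g) (≋-sym x≈w) w∈g
    where
    y∈z : y ∈ span z
    y∈z = ∈-resp-≈ᵥ (span z)
      (≋-trans (+ᵥ-cong x≈y+w ≋-refl) (≋-trans (+ᵥ-cong (+ᵥ-comm y w) ≋-refl) (xyx⁻¹≈y w y)))
      (+ᵥ-∈ (span z) x∈z (·ᵥ-∈ (- 1#) (span z) (span-⊆ (span z) g⊆z w w∈g)))
    x≈w : x ≈ᵥ w
    x≈w = ≋-trans x≈y+w (≋-trans (+ᵥ-cong (span-++-disjoint a z indep y∈a y∈z) ≋-refl) (+ᵥ-identityˡ w))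

  module _ {p} {P : Subspace → Set p} where

    CountIs-resp : ∀ {p′} {P′ : Subspace → Set p′} {N} → (∀ A → P A → P′ A) → (∀ A → P′ A → P A) →
      CountIs P N → CountIs P′ N
    CountIs-resp P⇒P′ P′⇒P (L , L-P , L-injective , L-onto) =
      L , (λ i → P⇒P′ _ (L-P i)) , L-injective , (λ A P′A → L-onto A (P′⇒P A P′A))

    CountIs-empty : (∀ A → ¬ P A) → CountIs P 0
    CountIs-empty ¬P = (λ ()) , (λ ()) , (λ ()) , (λ A PA → contradiction PA (¬P A))

    CountIs-singleton : ∀ {A} → P A → (∀ A′ → P A′ → A′ ≈ₛ A) → CountIs P 1
    CountIs-singleton {A} PA unique = (λ _ → A) , (λ _ → PA) , (λ { Fin.zero Fin.zero _ → ≡.refl }) ,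
      (λ A′ PA′ → Fin.zero , unique A′ PA′)


    CountIs-fromList : ∀ {Ss : List Subspace} → Unique (DecSetoid.setoid subspaceDecSetoid) Ss →
      ListAll.All P Ss → (∀ A → P A → Any (A ≈ₛ_) Ss) → CountIs P (length Ss)
    CountIs-fromList {Ss} unique all-P complete =
      List.lookup Ss , (λ i → ListAll.lookup all-P (∈-lookup i)) ,
      unique⇒lookup-injective (DecSetoid.setoid subspaceDecSetoid) unique ,
      (λ A PA → ListAny.index (complete A PA) , ListAnyP.lookup-index (complete A PA))

module AdmissibleSubspaces {c ℓ} (F : FiniteField c ℓ) (n : ℕ) where
  open ListCounting
  open import Level using (_⊔_)
  open import Data.Nat using (_+_; _*_; _≤_)
  import Data.Nat.Properties as ℕₚ
  open import Data.List.Base using (List; length; map; filter; lookup; cartesianProduct; deduplicate)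
  open import Data.List.Properties using (length-map)
  import Data.List.Relation.Unary.All as ListAll
  import Data.List.Relation.Unary.All.Properties as ListAllP
  open import Data.List.Relation.Unary.Any as ListAny using (Any)
  import Data.List.Relation.Unary.Any.Properties as ListAnyP
  import Data.List.Membership.Setoid.Properties as ∈ₗ
  open import Data.List.Relation.Unary.Unique.DecSetoid.Properties using (deduplicate-!)
  open import Data.List.Relation.Unary.Unique.Setoid using (Unique)
  import Data.Vec.Relation.Binary.Equality.Setoid as VecEquality
  open import Data.Product using (_×_; _,_; proj₁; proj₂)
  open import Data.Vec using (Vec; _++_)
  open import Data.Vec.Relation.Binary.Pointwise.Inductive as Pointwise using (Pointwise)
  open import Data.Vec.Relation.Unary.All as All using (All)
  import Data.Vec.Relation.Unary.All.Properties as AllP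
  open import Function using (_⇔_; mk⇔)
  open import Relation.Binary using (DecSetoid)
  open import Relation.Binary.PropositionalEquality as ≡ using (_≡_)
  open import Relation.Nullary using (Dec; ¬_)
  open import Relation.Nullary.Decidable using (_×-dec_)

  open FiniteField F using (q; setoid)
  open Linear F n hiding (_+ᵥ_; _·ᵥ_; 0ᵥ; _≈ᵥ_)
  open VectorArithmetic F
  open Subspaces F n
  open import Data.Vec.Relation.Binary.Equality.Setoid setoid using (≋-refl; ≋-setoid)
  module Tuples = VecEquality (≋-setoid n)
  open DecSetoid subspaceDecSetoid using () renaming (sym to ≈ₛ-sym; trans to ≈ₛ-trans)

  module Setting (U W : Subspace) (j k l : ℕ) (B : Subspace) (m : ℕ)
           {u : Vec Vect j} (indep-u : Independent u) (u-basis : span u ≈ₛ U)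
           {z : Vec Vect k} (indep-z : Independent z) (z-basis : span z ≈ₛ (U ⊕ W))
           {b : Vec Vect m} (indep-b : Independent b) (b-basis : span b ≈ₛ B) where

    -- The possible values of U⁺ on the event U⁺ + W = B.
    Admissible : Subspace → Set (c ⊔ ℓ)
    Admissible A = HasDim A l × U ⊆ A × (A ⊕ W) ≈ₛ B

    Z : Subspace
    Z = span z

    U⊆Z : U ⊆ Z
    U⊆Z = ⊆-trans (⊆-⊕ˡ U W) (proj₂ z-basis)

    W⊆Z : W ⊆ Z
    W⊆Z = ⊆-trans (⊆-⊕ʳ U W) (proj₂ z-basis)

    u⊆Z : All (_∈ Z) u
    u⊆Z = All.map (λ v∈u → U⊆Z _ (proj₁ u-basis _ v∈u)) (gens-∈-span u)

    admissible⇒⊆B : ∀ {A} → Admissible A → A ⊆ B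
    admissible⇒⊆B (_ , _ , A⊕W≈B) = ⊆-trans (⊆-⊕ˡ _ W) (proj₁ A⊕W≈B)

    admissible-resp-≈ₛ : ∀ {A A′} → A ≈ₛ A′ → Admissible A → Admissible A′
    admissible-resp-≈ₛ (A⊆A′ , A′⊆A) ((α , lin-α , α⊆A , A⊆α) , U⊆A , (A⊕W⊆B , B⊆A⊕W)) =
      (α , lin-α , ⊆-trans α⊆A A⊆A′ , ⊆-trans A′⊆A A⊆α) , ⊆-trans U⊆A A⊆A′ ,
      (⊆-trans (⊕-monoˡ W A′⊆A) A⊕W⊆B , ⊆-trans B⊆A⊕W (⊕-monoˡ W A⊆A′))

    weight-in-support : ∀ A → HasDim A l × U ⊆ A × A ⊆ B × (A ⊕ W) ≈ₛ B →
      CountIs (λ A′ → HasDim A′ l × U ⊆ A′ × A′ ≈ₛ A × (A′ ⊕ W) ≈ₛ B) 1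
    weight-in-support A (dim , U⊆A , _ , A⊕W≈B) =
      CountIs-singleton (dim , U⊆A , (⊆-refl , ⊆-refl) , A⊕W≈B) (λ A′ (_ , _ , A′≈A , _) → A′≈A)

    weight-outside-support : ∀ A → ¬ (HasDim A l × U ⊆ A × A ⊆ B × (A ⊕ W) ≈ₛ B) →
      CountIs (λ A′ → HasDim A′ l × U ⊆ A′ × A′ ≈ₛ A × (A′ ⊕ W) ≈ₛ B) 0
    weight-outside-support A ¬support = CountIs-empty λ A′ (dim , U⊆A′ , A′≈A , A′⊕W≈B) →
      let admissible = admissible-resp-≈ₛ A′≈A (dim , U⊆A′ , A′⊕W≈B)
          (dimA , U⊆A , A⊕W≈B) = admissible
      in ¬support (dimA , U⊆A , admissible⇒⊆B admissible , A⊕W≈B)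

    Z⊆B : ∀ {A} → Admissible A → Z ⊆ B
    Z⊆B (_ , U⊆A , A⊕W≈B) = ⊆-trans (proj₁ z-basis) (⊆-trans (⊕-monoˡ W U⊆A) (proj₁ A⊕W≈B))

    -- A basis a′ ++ c′ ++ u of A in which c′ ++ u is a basis of A ∩ Z.
    record Decomposition (A : Subspace) : Set (c ⊔ ℓ) where
      field
        {r₁ r₂} : ℕ
        c′ : Vec Vect r₁
        a′ : Vec Vect r₂
        c′-extends : Extends z u c′
        a′-extends : Extends b z a′
        spans : span (a′ ++ (c′ ++ u)) ≈ₛ A
        dim-B : r₂ + k ≡ m
        dim-A : r₂ + (r₁ + j) ≡ l

    decompose : ∀ {A} → Admissible A → Decomposition A
    decompose {A} admissible@((α , lin-α , α-basis) , U⊆A , A⊕W≈B) = record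
      { c′ = c′ ; a′ = a′
      ; c′-extends = All.map proj₂ c′⊆A∩Z , indep-c′
      ; a′-extends = All.map (λ v∈A → proj₂ b-basis _ (A⊆B _ v∈A)) a′⊆A , indep-a′z
      ; spans = span-⊆ A a′c′u⊆A , spans-A
      ; dim-B = ℕₚ.≤-antisym (dim-mono indep-a′z indep-b a′z⊆b) (dim-mono indep-b indep-a′z b⊆a′z)
      ; dim-A = ℕₚ.≤-antisym (dim-mono indep-a′ indep-α (⊆-trans (span-⊆ A a′c′u⊆A) (proj₂ α-basis)))
                              (dim-mono indep-α indep-a′ (⊆-trans (proj₁ α-basis) spans-A)) }
      where
      open Completion (greedyCompletion (λ v → (v ∈? A) ×-dec (v ∈? Z))
        (λ v≈w (v∈A , v∈Z) → ∈-resp-≈ᵥ A v≈w v∈A , ∈-resp-≈ᵥ Z v≈w v∈Z) u indep-u)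
        renaming (extra to c′; independent to indep-c′; within to c′⊆A∩Z; spans to spans-A∩Z)
      open Completion (greedyCompletion (_∈? A) (∈-resp-≈ᵥ A) (c′ ++ u) indep-c′)
        renaming (extra to a′; independent to indep-a′; within to a′⊆A; spans to spans-A)
      indep-α : Independent α
      indep-α = LinIndep⇒Independent α lin-α
      A⊆B : A ⊆ B
      A⊆B = ⊆-trans (⊆-⊕ˡ A W) (proj₁ A⊕W≈B)
      a′c′u⊆A : All (_∈ A) (a′ ++ (c′ ++ u))
      a′c′u⊆A = AllP.++⁺ a′⊆A (AllP.++⁺ (All.map proj₁ c′⊆A∩Z)
        (All.map (λ v∈u → U⊆A _ (proj₁ u-basis _ v∈u)) (gens-∈-span u)))
      c′u⊆Z : span (c′ ++ u) ⊆ Z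
      c′u⊆Z = span-⊆ Z (AllP.++⁺ (All.map proj₂ c′⊆A∩Z) u⊆Z)
      indep-a′z : Independent (a′ ++ z)
      indep-a′z = independent-++-⊇ʳ A indep-z a′⊆A (λ v v∈A v∈Z → spans-A∩Z v (v∈A , v∈Z)) indep-a′
      a′z⊆b : span (a′ ++ z) ⊆ span b
      a′z⊆b = span-⊆ (span b) (AllP.++⁺ (All.map (λ v∈A → proj₂ b-basis _ (A⊆B _ v∈A)) a′⊆A)
        (All.map (λ v∈z → proj₂ b-basis _ (Z⊆B admissible _ v∈z)) (gens-∈-span z)))
      b⊆a′z : span b ⊆ span (a′ ++ z)
      b⊆a′z = ⊆-trans (proj₁ b-basis) (⊆-trans (proj₂ A⊕W≈B)
        (⊕-least (⊆-trans spans-A (span-++-monoʳ a′ c′u⊆Z)) (⊆-trans W⊆Z (λ v → ∈-span-++ʳ a′ z))))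

    module Counting {A₀ : Subspace} (admissible-A₀ : Admissible A₀) where
      open Decomposition (decompose admissible-A₀) using (r₁; r₂; dim-B; dim-A) public

      r₁+j≤k : r₁ + j ≤ k
      r₁+j≤k = dim-mono (proj₂ c₀-extends) indep-z (span-⊆ Z (AllP.++⁺ (proj₁ c₀-extends) u⊆Z))
        where
        c₀-extends : Extends z u (Decomposition.c′ (decompose admissible-A₀))
        c₀-extends = Decomposition.c′-extends (decompose admissible-A₀)

      Z⊆b : Z ⊆ span b
      Z⊆b = ⊆-trans (Z⊆B admissible-A₀) (proj₂ b-basis)

      Pair : Set c
      Pair = Vec Vect r₂ × Vec Vect r₁

      ValidPair : Pair → Set (c ⊔ ℓ)
      ValidPair (a , c′) = Extends b z a × Extends z u c′

      choices₁ : List (Vec Vect r₁)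
      choices₁ = filter (extends? z u) (vectors allVectors r₁)

      choices₂ : List (Vec Vect r₂)
      choices₂ = filter (extends? b z) (vectors allVectors r₂)

      validPairs : List Pair
      validPairs = cartesianProduct choices₂ choices₁

      subspaceOf : Pair → Subspace
      subspaceOf (a , c′) = span (a ++ (c′ ++ u))

      validPairs-valid : ListAll.All ValidPair validPairs
      validPairs-valid = ListAllP.cartesianProduct⁺ (≡.setoid _) (≡.setoid _) choices₂ choices₁
        (λ a∈ c∈ → ListAll.lookup (ListAllP.all-filter (extends? b z) (vectors allVectors r₂)) a∈ ,
                   ListAll.lookup (ListAllP.all-filter (extends? z u) (vectors allVectors r₁)) c∈)

      length-validPairs : length validPairs ≡ extensionCount q m k r₂ * extensionCount q k j r₁
      length-validPairs = ≡.trans (length-cartesianProductWith _,_ choices₂ choices₁)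
        (≡.cong₂ _*_ (count-extensions indep-b indep-z z⊆b r₂) (count-extensions indep-z indep-u u⊆Z r₁))
        where
        z⊆b : All (_∈ span b) z
        z⊆b = All.map (Z⊆b _) (gens-∈-span z)

      subspaceOf-independent : ∀ {p} → ValidPair p → Independent (proj₁ p ++ (proj₂ p ++ u))
      subspaceOf-independent {a , c′} ((_ , indep-az) , (c′⊆Z , indep-c′u)) =
        independent-++-⊆ʳ a indep-c′u (span-⊆ Z (AllP.++⁺ c′⊆Z u⊆Z)) indep-az

      subspaceOf-admissible : ∀ {p} → ValidPair p → Admissible (subspaceOf p)
      subspaceOf-admissible {p@(a , c′)} valid@((a⊆b , indep-az) , (c′⊆Z , _)) =
        ≡.subst (HasDim (subspaceOf p)) dim-A
          (_ , Independent⇒LinIndep _ (subspaceOf-independent valid) , ⊆-refl , ⊆-refl) ,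
        U⊆A , (⊕-least A⊆B (⊆-trans W⊆Z (Z⊆B admissible-A₀)) , B⊆A⊕W)
        where
        U⊆A : U ⊆ subspaceOf p
        U⊆A = ⊆-trans (proj₂ u-basis) (λ v v∈u → ∈-span-++ʳ a (c′ ++ u) (∈-span-++ʳ c′ u v∈u))
        A⊆B : subspaceOf p ⊆ B
        A⊆B = ⊆-trans (span-⊆ (span b) (AllP.++⁺ a⊆b (All.map (Z⊆b _) (AllP.++⁺ c′⊆Z u⊆Z))))
          (proj₁ b-basis)
        b⊆az : span b ⊆ span (a ++ z)
        b⊆az = dim-≡⇒⊇ dim-B indep-az indep-b
          (span-⊆ (span b) (AllP.++⁺ a⊆b (All.map (Z⊆b _) (gens-∈-span z))))
        az⊆A⊕W : span (a ++ z) ⊆ (subspaceOf p ⊕ W)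
        az⊆A⊕W = span-⊆ _ (AllP.++⁺
          (All.map (λ v∈a → ⊆-⊕ˡ (subspaceOf p) W _ (∈-span-++ˡ a (c′ ++ u) v∈a)) (gens-∈-span a))
          (All.map (⊆-trans (proj₁ z-basis) (⊕-monoˡ W U⊆A) _) (gens-∈-span z)))
        B⊆A⊕W : B ⊆ (subspaceOf p ⊕ W)
        B⊆A⊕W = ⊆-trans (proj₂ b-basis) (⊆-trans b⊆az az⊆A⊕W)

      -- The pairs spanning S₀ = subspaceOf p₀ are those whose second component extends u inside
      -- S₀ ∩ Z = span (c₀ ++ u) and whose first component then extends c₀ ++ u inside S₀.
      module Fibre {p₀ : Pair} (valid₀ : ValidPair p₀) where
        private
          a₀ : Vec Vect r₂
          a₀ = proj₁ p₀
          c₀ : Vec Vect r₁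
          c₀ = proj₂ p₀

        S₀ : Subspace
        S₀ = subspaceOf p₀

        g₀ : Vec Vect (r₁ + j)
        g₀ = c₀ ++ u

        indep₀ : Independent (a₀ ++ g₀)
        indep₀ = subspaceOf-independent valid₀

        indep-g₀ : Independent g₀
        indep-g₀ = proj₂ (proj₂ valid₀)

        g₀⊆Z : All (_∈ Z) g₀
        g₀⊆Z = AllP.++⁺ (proj₁ (proj₂ valid₀)) u⊆Z

        g₀⊆S₀ : All (_∈ S₀) g₀
        g₀⊆S₀ = All.map (∈-span-++ʳ a₀ g₀) (gens-∈-span g₀)

        u⊆g₀ : All (_∈ span g₀) u
        u⊆g₀ = All.map (∈-span-++ʳ c₀ u) (gens-∈-span u)

        S₀∩Z⊆g₀ : ∀ v → v ∈ S₀ → v ∈ Z → v ∈ span g₀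
        S₀∩Z⊆g₀ = span-++-∩ a₀ (proj₂ (proj₁ valid₀)) g₀⊆Z

        extends-within-b : ∀ {a : Vec Vect r₂} → Extends (a₀ ++ g₀) g₀ a → Extends b z a
        extends-within-b (a⊆S₀ , indep-ag₀) =
          All.map (span-⊆ (span b) (AllP.++⁺ (proj₁ (proj₁ valid₀)) (All.map (Z⊆b _) g₀⊆Z)) _) a⊆S₀ ,
          independent-++-⊇ʳ S₀ indep-z a⊆S₀ S₀∩Z⊆g₀ indep-ag₀

        extends-within-Z : ∀ {c′ : Vec Vect r₁} → Extends g₀ u c′ → Extends z u c′
        extends-within-Z (c′⊆g₀ , indep-c′u) = All.map (span-⊆ Z g₀⊆Z _) c′⊆g₀ , indep-c′u

        same-subspace⇔ : ∀ {p} → ValidPair p →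
          (S₀ ≈ₛ subspaceOf p) ⇔ (Extends (a₀ ++ g₀) g₀ (proj₁ p) × Extends g₀ u (proj₂ p))
        same-subspace⇔ {p@(a , c′)} valid@((_ , indep-az) , (c′⊆Z , indep-c′u)) = mk⇔ to from
          where
          to : S₀ ≈ₛ subspaceOf p → Extends (a₀ ++ g₀) g₀ a × Extends g₀ u c′
          to (_ , p⊆S₀) =
            (All.map (λ v∈a → p⊆S₀ _ (∈-span-++ˡ a (c′ ++ u) v∈a)) (gens-∈-span a) ,
             independent-++-⊆ʳ a indep-g₀ (span-⊆ Z g₀⊆Z) indep-az) ,
            (All.map (λ (v∈c′ , v∈Z) → S₀∩Z⊆g₀ _ (p⊆S₀ _ (∈-span-++ʳ a (c′ ++ u) (∈-span-++ˡ c′ u v∈c′))) v∈Z)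
               (All.zip (gens-∈-span c′ , c′⊆Z)) ,
             indep-c′u)
          from : Extends (a₀ ++ g₀) g₀ a × Extends g₀ u c′ → S₀ ≈ₛ subspaceOf p
          from ((a⊆S₀ , _) , (c′⊆g₀ , _)) = dim-≡⇒⊇ ≡.refl (subspaceOf-independent valid) indep₀ p⊆S₀ , p⊆S₀
            where
            p⊆S₀ : subspaceOf p ⊆ S₀
            p⊆S₀ = span-⊆ S₀ (AllP.++⁺ a⊆S₀
              (AllP.++⁺ (All.map (∈-span-++ʳ a₀ g₀) c′⊆g₀) (All.map (∈-span-++ʳ a₀ g₀) u⊆g₀)))

        cardinality : count (λ p → S₀ ≈ₛ? subspaceOf p) validPairs
          ≡ extensionCount q (r₂ + (r₁ + j)) (r₁ + j) r₂ * extensionCount q (r₁ + j) j r₁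
        cardinality = begin
          count (λ p → S₀ ≈ₛ? subspaceOf p) validPairs
            ≡⟨ count-cong _ _ (ListAll.map same-subspace⇔ validPairs-valid) ⟩
          count (λ (a , c′) → extends? (a₀ ++ g₀) g₀ a ×-dec extends? g₀ u c′) validPairs
            ≡⟨ count-cartesianProduct (extends? (a₀ ++ g₀) g₀) (extends? g₀ u) choices₂ choices₁ ⟩
          count (extends? (a₀ ++ g₀) g₀) choices₂ * count (extends? g₀ u) choices₁
            ≡⟨ ≡.cong₂ _*_
                 (count-filter-⇒ (extends? (a₀ ++ g₀) g₀) (extends? b z) extends-within-b (vectors allVectors r₂))
                 (count-filter-⇒ (extends? g₀ u) (extends? z u) extends-within-Z (vectors allVectors r₁)) ⟩
          count (extends? (a₀ ++ g₀) g₀) (vectors allVectors r₂) * count (extends? g₀ u) (vectors allVectors r₁)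
            ≡⟨ ≡.cong₂ _*_ (count-extensions indep₀ indep-g₀ g₀⊆S₀ r₂)
                           (count-extensions indep-g₀ indep-u u⊆g₀ r₁) ⟩
          extensionCount q (r₂ + (r₁ + j)) (r₁ + j) r₂ * extensionCount q (r₁ + j) j r₁ ∎
          where open ≡.≡-Reasoning

      valid-pair-found : ∀ {A} → Admissible A → Any (λ p → A ≈ₛ subspaceOf p) validPairs
      valid-pair-found {A} admissible = found c′ a′ sizes₁ sizes₂ c′-extends a′-extends spans
        where
        D : Decomposition A
        D = decompose admissible
        open Decomposition D using (c′; a′; c′-extends; a′-extends; spans)
        sizes₂ : Decomposition.r₂ D ≡ r₂
        sizes₂ = ℕₚ.+-cancelʳ-≡ k _ _ (≡.trans (Decomposition.dim-B D) (≡.sym dim-B))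
        sizes₁ : Decomposition.r₁ D ≡ r₁
        sizes₁ = ℕₚ.+-cancelʳ-≡ j _ _ (ℕₚ.+-cancelˡ-≡ r₂ _ _
          (≡.trans (≡.cong (_+ (Decomposition.r₁ D + j)) (≡.sym sizes₂))
            (≡.trans (Decomposition.dim-A D) (≡.sym dim-A))))
        found : ∀ {s₁ s₂} (c″ : Vec Vect s₁) (a″ : Vec Vect s₂) → s₁ ≡ r₁ → s₂ ≡ r₂ →
          Extends z u c″ → Extends b z a″ → span (a″ ++ (c″ ++ u)) ≈ₛ A →
          Any (λ p → A ≈ₛ subspaceOf p) validPairs
        found c″ a″ ≡.refl ≡.refl c″-extends a″-extends A≈ = ListAny.map
          (λ (a″≈ , c″≈) → ≈ₛ-trans (≈ₛ-sym A≈)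
            (same-span a″≈ c″≈ , same-span (Tuples.≋-sym a″≈) (Tuples.≋-sym c″≈)))
          (ListAnyP.cartesianProduct⁺ (chosen (extends? b z) a″-extends) (chosen (extends? z u) c″-extends))
          where
          same-span : ∀ {a a′ c c′} → Pointwise _≈ᵥ_ a a′ → Pointwise _≈ᵥ_ c c′ →
            span (a ++ (c ++ u)) ⊆ span (a′ ++ (c′ ++ u))
          same-span a≈ c≈ = span-resp-≈ᵥ (Pointwise.++⁺ a≈ (Pointwise.++⁺ c≈ (Tuples.≋-refl)))
          chosen : ∀ {s i r} {g : Vec Vect s} {h : Vec Vect i} (ext? : ∀ t → Dec (Extends g h t))
            {t : Vec Vect r} → Extends g h t → Any (Pointwise _≈ᵥ_ t) (filter ext? (vectors allVectors r))
          chosen ext? ext = ∈ₗ.∈-filter⁺ (Tuples.≋-setoid _) ext? extends-resp-≈ᵥ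
            (vectors-complete (≋-setoid n) allVectors-complete _) ext

      candidates : List Subspace
      candidates = map subspaceOf validPairs

      admissibleSubspaces : List Subspace
      admissibleSubspaces = deduplicate _≈ₛ?_ candidates

      admissibleSubspaces-admissible : ListAll.All Admissible admissibleSubspaces
      admissibleSubspaces-admissible = ListAllP.deduplicate⁺ _≈ₛ?_
        (ListAllP.map⁺ (ListAll.map subspaceOf-admissible validPairs-valid))

      admissibleSubspaces-unique : Unique (DecSetoid.setoid subspaceDecSetoid) admissibleSubspaces
      admissibleSubspaces-unique = deduplicate-! subspaceDecSetoid candidates

      admissibleSubspaces-complete : ∀ {A} → Admissible A → Any (A ≈ₛ_) admissibleSubspaces
      admissibleSubspaces-complete admissible = ListAnyP.deduplicate⁺ _≈ₛ?_ (λ S≈T A≈S → ≈ₛ-trans A≈S (≈ₛ-sym S≈T))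
        (ListAnyP.map⁺ (valid-pair-found admissible))

      N : ℕ
      N = length admissibleSubspaces

      count-admissible : CountIs Admissible N
      count-admissible = CountIs-fromList admissibleSubspaces-unique admissibleSubspaces-admissible
        (λ _ → admissibleSubspaces-complete)

      count-admissible-⊆B : CountIs (λ A → HasDim A l × U ⊆ A × A ⊆ B × (A ⊕ W) ≈ₛ B) N
      count-admissible-⊆B = CountIs-resp
        (λ A admissible@(dim , U⊆A , A⊕W≈B) → dim , U⊆A , admissible⇒⊆B admissible , A⊕W≈B)
        (λ A (dim , U⊆A , _ , A⊕W≈B) → dim , U⊆A , A⊕W≈B) count-admissible

      length-admissibleSubspaces : N *
          (extensionCount q (r₂ + (r₁ + j)) (r₁ + j) r₂ * extensionCount q (r₁ + j) j r₁)
        ≡ extensionCount q m k r₂ * extensionCount q k j r₁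
      length-admissibleSubspaces = ≡.trans
        (length-deduplicate-* subspaceDecSetoid candidates _ (ListAllP.map⁺ (ListAll.map
          (λ {p₀} valid₀ →
            ≡.trans (count-map (subspaceOf p₀ ≈ₛ?_) subspaceOf validPairs) (Fibre.cardinality valid₀))
          validPairs-valid)))
        (≡.trans (length-map subspaceOf validPairs) length-validPairs)

module RationalArithmetic where
  open import Data.Rational as ℚ using (ℚ; 0ℚ; 1ℚ; mkℚ; _+_; _*_; _-_; toℚᵘ)
  import Data.Rational.Properties as ℚₚ
  import Data.Rational.Unnormalised as ℚᵘ
  import Data.Rational.Unnormalised.Properties as ℚᵘₚ
  open import Data.Integer using (+_)
  import Data.Integer as ℤ
  import Data.Integer.Properties as ℤₚ
  import Data.Nat.Properties as ℕₚ
  import Data.Nat.Coprimality as Coprimality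
  open import Data.Rational.Solver using (module +-*-Solver)
  open +-*-Solver
  open import Relation.Binary.PropositionalEquality
  open import Relation.Nullary using (¬_)

  fromℕ≡mkℚ : ∀ a → fromℕ a ≡ mkℚ (+ a) 0 (Coprimality.sym (Coprimality.1-coprimeTo a))
  fromℕ≡mkℚ a = ℚₚ.normalize-coprime (Coprimality.sym (Coprimality.1-coprimeTo a))

  toℚᵘ-fromℕ : ∀ a → toℚᵘ (fromℕ a) ≡ ℚᵘ.mkℚᵘ (+ a) 0
  toℚᵘ-fromℕ a = cong toℚᵘ (fromℕ≡mkℚ a)

  fromℕ-+ : ∀ a b → fromℕ (a ℕ.+ b) ≡ fromℕ a + fromℕ b
  fromℕ-+ a b = ℚₚ.toℚᵘ-injective (begin
    toℚᵘ (fromℕ (a ℕ.+ b)) ≡⟨ toℚᵘ-fromℕ (a ℕ.+ b) ⟩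
    ℚᵘ.mkℚᵘ (+ (a ℕ.+ b)) 0 ≈⟨ ℚᵘ.*≡* (cong (ℤ._* + 1) (trans (ℤₚ.pos-+ a b)
                                 (sym (cong₂ ℤ._+_ (ℤₚ.*-identityʳ (+ a)) (ℤₚ.*-identityʳ (+ b)))))) ⟩
    ℚᵘ.mkℚᵘ (+ a) 0 ℚᵘ.+ ℚᵘ.mkℚᵘ (+ b) 0 ≡⟨ sym (cong₂ ℚᵘ._+_ (toℚᵘ-fromℕ a) (toℚᵘ-fromℕ b)) ⟩
    toℚᵘ (fromℕ a) ℚᵘ.+ toℚᵘ (fromℕ b) ≈⟨ ℚᵘₚ.≃-sym (ℚₚ.toℚᵘ-homo-+ (fromℕ a) (fromℕ b)) ⟩
    toℚᵘ (fromℕ a + fromℕ b) ∎)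
    where open ℚᵘₚ.≃-Reasoning

  fromℕ-* : ∀ a b → fromℕ (a ℕ.* b) ≡ fromℕ a * fromℕ b
  fromℕ-* a b = ℚₚ.toℚᵘ-injective (begin
    toℚᵘ (fromℕ (a ℕ.* b)) ≡⟨ toℚᵘ-fromℕ (a ℕ.* b) ⟩
    ℚᵘ.mkℚᵘ (+ (a ℕ.* b)) 0 ≈⟨ ℚᵘ.*≡* (cong (ℤ._* + 1) (ℤₚ.pos-* a b)) ⟩
    ℚᵘ.mkℚᵘ (+ a) 0 ℚᵘ.* ℚᵘ.mkℚᵘ (+ b) 0 ≡⟨ sym (cong₂ ℚᵘ._*_ (toℚᵘ-fromℕ a) (toℚᵘ-fromℕ b)) ⟩
    toℚᵘ (fromℕ a) ℚᵘ.* toℚᵘ (fromℕ b) ≈⟨ ℚᵘₚ.≃-sym (ℚₚ.toℚᵘ-homo-* (fromℕ a) (fromℕ b)) ⟩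
    toℚᵘ (fromℕ a * fromℕ b) ∎)
    where open ℚᵘₚ.≃-Reasoning

  fromℕ-∸ : ∀ {a b} → b ℕ.≤ a → fromℕ (a ℕ.∸ b) ≡ fromℕ a - fromℕ b
  fromℕ-∸ {a} {b} b≤a = begin
    fromℕ (a ℕ.∸ b) ≡⟨ solve 2 (λ d e → d := (d :+ e) :- e) refl (fromℕ (a ℕ.∸ b)) (fromℕ b) ⟩
    (fromℕ (a ℕ.∸ b) + fromℕ b) - fromℕ b ≡⟨ cong (_- fromℕ b) (sym (fromℕ-+ (a ℕ.∸ b) b)) ⟩
    fromℕ (a ℕ.∸ b ℕ.+ b) - fromℕ b ≡⟨ cong (λ c → fromℕ c - fromℕ b) (ℕₚ.m∸n+n≡m b≤a) ⟩
    fromℕ a - fromℕ b ∎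
    where open ≡-Reasoning

  fromℕ-injective : ∀ {a b} → fromℕ a ≡ fromℕ b → a ≡ b
  fromℕ-injective {a} {b} eq = ℤₚ.+-injective (cong ℚ.↥_ (trans (sym (fromℕ≡mkℚ a)) (trans eq (fromℕ≡mkℚ b))))

  ^ℚ-+ : ∀ y a b → y ^ℚ (a ℕ.+ b) ≡ y ^ℚ a * y ^ℚ b
  ^ℚ-+ y zero b = sym (ℚₚ.*-identityˡ _)
  ^ℚ-+ y (suc a) b = trans (cong (y *_) (^ℚ-+ y a b)) (sym (ℚₚ.*-assoc y _ _))

  *-^ℚ : ∀ y w a → (y * w) ^ℚ a ≡ y ^ℚ a * w ^ℚ a
  *-^ℚ y w zero = refl
  *-^ℚ y w (suc a) = trans (cong ((y * w) *_) (*-^ℚ y w a))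
    (solve 4 (λ y w yᵃ wᵃ → (y :* w) :* (yᵃ :* wᵃ) := (y :* yᵃ) :* (w :* wᵃ)) refl y w (y ^ℚ a) (w ^ℚ a))

  1^ℚ : ∀ a → 1ℚ ^ℚ a ≡ 1ℚ
  1^ℚ zero = refl
  1^ℚ (suc a) = trans (ℚₚ.*-identityˡ _) (1^ℚ a)

  *-cancelʳ : ∀ {x y} z → ¬ z ≡ 0ℚ → x * z ≡ y * z → x ≡ y
  *-cancelʳ {x} {y} z z≢0 eq = begin
    x ≡⟨ solve 2 (λ x z⁻¹ → x := x :* con 1ℚ) refl x z⁻¹ ⟩
    x * 1ℚ ≡⟨ cong (x *_) (sym (ℚₚ.*-inverseʳ z {{nonZero}})) ⟩
    x * (z * z⁻¹) ≡⟨ sym (ℚₚ.*-assoc x z z⁻¹) ⟩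
    (x * z) * z⁻¹ ≡⟨ cong (_* z⁻¹) eq ⟩
    (y * z) * z⁻¹ ≡⟨ ℚₚ.*-assoc y z z⁻¹ ⟩
    y * (z * z⁻¹) ≡⟨ cong (y *_) (ℚₚ.*-inverseʳ z {{nonZero}}) ⟩
    y * 1ℚ ≡⟨ ℚₚ.*-identityʳ y ⟩
    y ∎
    where
    open ≡-Reasoning
    nonZero : ℚ.NonZero z
    nonZero = ℚ.≢-nonZero z≢0
    z⁻¹ : ℚ
    z⁻¹ = ℚ.1/_ z {{nonZero}}

  fromℕ*inv≡1 : ∀ {a} → 1 ℕ.≤ a → fromℕ a * inv a ≡ 1ℚ
  fromℕ*inv≡1 {suc a} _ = trans
    (cong₂ _*_ (fromℕ≡mkℚ (suc a)) (ℚₚ.normalize-coprime (Coprimality.1-coprimeTo (suc a))))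
    (ℚₚ.*-inverseʳ (mkℚ (+ suc a) 0 (Coprimality.sym (Coprimality.1-coprimeTo (suc a)))))

module PochhammerIdentity (q : ℕ) (q≥2 : 2 ℕ.≤ q) where
  open RationalArithmetic
  open import Data.Rational as ℚ using (ℚ; 0ℚ; 1ℚ; _*_; _-_)
  import Data.Rational.Properties as ℚₚ
  import Data.Nat.Properties as ℕₚ
  open import Data.Rational.Solver using (module +-*-Solver)
  open +-*-Solver
  open import Algebra.Apartness.Properties.HeytingCommutativeRing ℚₚ.heytingCommutativeRing using (x#0y#0→xy#0)
  open import Relation.Binary.PropositionalEquality
  open import Relation.Nullary using (¬_)
  open import Data.Nat.Tactic.RingSolver using (solve-∀)
  open import Data.Product using (_×_; _,_)

  instance
    q≢0 : ℕ.NonZero q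
    q≢0 = ℕ.>-nonZero (ℕₚ.≤-trans (ℕ.s≤s ℕ.z≤n) q≥2)

  Q q⁻¹ : ℚ
  Q = fromℕ q
  q⁻¹ = inv q

  Q^*q⁻¹^≡1 : ∀ a → Q ^ℚ a * q⁻¹ ^ℚ a ≡ 1ℚ
  Q^*q⁻¹^≡1 a = trans (sym (*-^ℚ Q q⁻¹ a))
    (trans (cong (_^ℚ a) (fromℕ*inv≡1 (ℕₚ.≤-trans (ℕ.s≤s ℕ.z≤n) q≥2))) (1^ℚ a))

  fromℕ-q^ : ∀ a → fromℕ (q ℕ.^ a) ≡ Q ^ℚ a
  fromℕ-q^ zero = refl
  fromℕ-q^ (suc a) = trans (fromℕ-* q (q ℕ.^ a)) (cong (Q *_) (fromℕ-q^ a))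

  Q^≢0 : ∀ a → ¬ Q ^ℚ a ≡ 0ℚ
  Q^≢0 a Q^a≡0 = ℚₚ.1≢0
    (trans (sym (Q^*q⁻¹^≡1 a)) (trans (cong (_* q⁻¹ ^ℚ a) Q^a≡0) (ℚₚ.*-zeroˡ (q⁻¹ ^ℚ a))))

  poch≢0 : ∀ t → ¬ poch q⁻¹ t ≡ 0ℚ
  poch≢0 zero ()
  poch≢0 (suc t) = x#0y#0→xy#0 (poch≢0 t) factor≢0
    where
    factor≢0 : ¬ 1ℚ - q⁻¹ ^ℚ suc t ≡ 0ℚ
    factor≢0 factor≡0 = ℕₚ.<⇒≢ (ℕₚ.<-≤-trans q≥2 (ℕₚ.m≤m*n q (q ℕ.^ t) {{ℕₚ.m^n≢0 q t}}))
      (sym (fromℕ-injective (begin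
      fromℕ (q ℕ.^ suc t) ≡⟨ fromℕ-q^ (suc t) ⟩
      Q ^ℚ suc t ≡⟨ solve 1 (λ Qᵃ → Qᵃ := Qᵃ :* (con 1ℚ :- con 0ℚ)) refl (Q ^ℚ suc t) ⟩
      Q ^ℚ suc t * (1ℚ - 0ℚ) ≡⟨ cong (λ f → Q ^ℚ suc t * (1ℚ - f)) (sym factor≡0) ⟩
      Q ^ℚ suc t * (1ℚ - (1ℚ - q⁻¹ ^ℚ suc t))
        ≡⟨ solve 2 (λ Qᵃ q⁻ᵃ → Qᵃ :* (con 1ℚ :- (con 1ℚ :- q⁻ᵃ)) := Qᵃ :* q⁻ᵃ) refl
             (Q ^ℚ suc t) (q⁻¹ ^ℚ suc t) ⟩
      Q ^ℚ suc t * q⁻¹ ^ℚ suc t ≡⟨ Q^*q⁻¹^≡1 (suc t) ⟩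
      1ℚ ∎)))
      where open ≡-Reasoning

  fromℕ-q^-∸-q^ : ∀ d w → fromℕ (q ℕ.^ (d ℕ.+ w) ℕ.∸ q ℕ.^ w) ≡ Q ^ℚ (d ℕ.+ w) * (1ℚ - q⁻¹ ^ℚ d)
  fromℕ-q^-∸-q^ d w = begin
    fromℕ (q ℕ.^ (d ℕ.+ w) ℕ.∸ q ℕ.^ w) ≡⟨ fromℕ-∸ (ℕₚ.^-monoʳ-≤ q (ℕₚ.m≤n+m w d)) ⟩
    fromℕ (q ℕ.^ (d ℕ.+ w)) - fromℕ (q ℕ.^ w) ≡⟨ cong₂ _-_ (fromℕ-q^ (d ℕ.+ w)) (fromℕ-q^ w) ⟩
    Q ^ℚ (d ℕ.+ w) - Q ^ℚ w ≡⟨ cong (Q ^ℚ (d ℕ.+ w) -_) Q^w≡ ⟩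
    Q ^ℚ (d ℕ.+ w) - Q ^ℚ (d ℕ.+ w) * q⁻¹ ^ℚ d
      ≡⟨ solve 2 (λ Qᵃ q⁻ᵈ → Qᵃ :- Qᵃ :* q⁻ᵈ := Qᵃ :* (con 1ℚ :- q⁻ᵈ)) refl (Q ^ℚ (d ℕ.+ w)) (q⁻¹ ^ℚ d) ⟩
    Q ^ℚ (d ℕ.+ w) * (1ℚ - q⁻¹ ^ℚ d) ∎
    where
    open ≡-Reasoning
    Q^w≡ : Q ^ℚ w ≡ Q ^ℚ (d ℕ.+ w) * q⁻¹ ^ℚ d
    Q^w≡ = begin
      Q ^ℚ w ≡⟨ sym (ℚₚ.*-identityˡ _) ⟩
      1ℚ * Q ^ℚ w ≡⟨ cong (_* Q ^ℚ w) (sym (Q^*q⁻¹^≡1 d)) ⟩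
      (Q ^ℚ d * q⁻¹ ^ℚ d) * Q ^ℚ w
        ≡⟨ solve 3 (λ Qᵈ q⁻ᵈ Qʷ → (Qᵈ :* q⁻ᵈ) :* Qʷ := (Qᵈ :* Qʷ) :* q⁻ᵈ) refl (Q ^ℚ d) (q⁻¹ ^ℚ d) (Q ^ℚ w) ⟩
      (Q ^ℚ d * Q ^ℚ w) * q⁻¹ ^ℚ d ≡⟨ cong (_* q⁻¹ ^ℚ d) (sym (^ℚ-+ Q d w)) ⟩
      Q ^ℚ (d ℕ.+ w) * q⁻¹ ^ℚ d ∎

  -- In closed form: extensionCount q s i r = q^{rs} (q⁻¹)_{s-i} / (q⁻¹)_{s-i-r}.
  extensionCount-poch : ∀ {s i} r e → e ℕ.+ (r ℕ.+ i) ≡ s →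
    fromℕ (extensionCount q s i r) * poch q⁻¹ e ≡ Q ^ℚ (r ℕ.* s) * poch q⁻¹ (e ℕ.+ r)
  extensionCount-poch zero e _ = cong (λ e′ → 1ℚ * poch q⁻¹ e′) (sym (ℕₚ.+-identityʳ e))
  extensionCount-poch {s} {i} (suc r) e e+r+i≡s = begin
    fromℕ (E ℕ.* D) * poch q⁻¹ e ≡⟨ cong (_* poch q⁻¹ e) (trans (fromℕ-* E D) (cong (fromℕ E *_) D≡)) ⟩
    (fromℕ E * (Q ^ℚ s * (1ℚ - q⁻¹ ^ℚ suc e))) * poch q⁻¹ e
      ≡⟨ solve 4 (λ E Qˢ f p → (E :* (Qˢ :* f)) :* p := (E :* (p :* f)) :* Qˢ) refl
           (fromℕ E) (Q ^ℚ s) (1ℚ - q⁻¹ ^ℚ suc e) (poch q⁻¹ e) ⟩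
    (fromℕ E * poch q⁻¹ (suc e)) * Q ^ℚ s ≡⟨ cong (_* Q ^ℚ s) (extensionCount-poch r (suc e) suc-e+r+i≡s) ⟩
    (Q ^ℚ (r ℕ.* s) * poch q⁻¹ (suc e ℕ.+ r)) * Q ^ℚ s
      ≡⟨ solve 3 (λ Qʳˢ p Qˢ → (Qʳˢ :* p) :* Qˢ := (Qˢ :* Qʳˢ) :* p) refl
           (Q ^ℚ (r ℕ.* s)) (poch q⁻¹ (suc e ℕ.+ r)) (Q ^ℚ s) ⟩
    (Q ^ℚ s * Q ^ℚ (r ℕ.* s)) * poch q⁻¹ (suc e ℕ.+ r)
      ≡⟨ cong₂ _*_ (sym (^ℚ-+ Q s (r ℕ.* s))) (cong (poch q⁻¹) (sym (ℕₚ.+-suc e r))) ⟩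
    Q ^ℚ (suc r ℕ.* s) * poch q⁻¹ (e ℕ.+ suc r) ∎
    where
    open ≡-Reasoning
    E D : ℕ
    E = extensionCount q s i r
    D = q ℕ.^ s ℕ.∸ q ℕ.^ (r ℕ.+ i)
    suc-e+r+i≡s : suc e ℕ.+ (r ℕ.+ i) ≡ s
    suc-e+r+i≡s = trans (sym (ℕₚ.+-suc e (r ℕ.+ i))) e+r+i≡s
    D≡ : fromℕ D ≡ Q ^ℚ s * (1ℚ - q⁻¹ ^ℚ suc e)
    D≡ = subst (λ s′ → fromℕ (q ℕ.^ s′ ℕ.∸ q ℕ.^ (r ℕ.+ i)) ≡ Q ^ℚ s′ * (1ℚ - q⁻¹ ^ℚ suc e))
      suc-e+r+i≡s (fromℕ-q^-∸-q^ (suc e) (r ℕ.+ i))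

  extensionCount-closed : ∀ {s i} r → r ℕ.+ i ≡ s →
    fromℕ (extensionCount q s i r) ≡ Q ^ℚ (r ℕ.* s) * poch q⁻¹ r
  extensionCount-closed r r+i≡s = trans (sym (ℚₚ.*-identityʳ _)) (extensionCount-poch r 0 r+i≡s)

  private
    exponent-identity : ∀ r₂ r₁ j t →
      r₁ ℕ.* ((r₁ ℕ.+ j) ℕ.+ t) ℕ.+ r₂ ℕ.* (r₂ ℕ.+ ((r₁ ℕ.+ j) ℕ.+ t))
        ≡ t ℕ.* (r₂ ℕ.+ r₁) ℕ.+ (r₂ ℕ.* (r₂ ℕ.+ (r₁ ℕ.+ j)) ℕ.+ r₁ ℕ.* (r₁ ℕ.+ j))
    exponent-identity = solve-∀

  -- r₂ = m − k, r₁ = dim (A ∩ Z) − j and t = k − r₁ − j, where Z = U + W.  Both sides are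
  -- multiplied by C ≠ 0 so that every extension count can be replaced by its closed form.
  pochhammer-count : ∀ N r₂ r₁ j t →
    let k = (r₁ ℕ.+ j) ℕ.+ t in
    N ℕ.* (extensionCount q (r₂ ℕ.+ (r₁ ℕ.+ j)) (r₁ ℕ.+ j) r₂ ℕ.* extensionCount q (r₁ ℕ.+ j) j r₁)
      ≡ extensionCount q (r₂ ℕ.+ k) k r₂ ℕ.* extensionCount q k j r₁ →
    fromℕ N * (poch q⁻¹ t * poch q⁻¹ r₁) ≡ fromℕ (q ℕ.^ (t ℕ.* (r₂ ℕ.+ r₁))) * poch q⁻¹ (t ℕ.+ r₁)
  pochhammer-count N r₂ r₁ j t N*fibre≡pairs = *-cancelʳ C C≢0 (begin
    (fromℕ N * (poch q⁻¹ t * poch q⁻¹ r₁)) * C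
      ≡⟨ solve 6 (λ N pₜ p₁ Qᵅ p₂ Qᵝ →
             (N :* (pₜ :* p₁)) :* ((Qᵅ :* p₂) :* Qᵝ) := (N :* ((Qᵅ :* p₂) :* (Qᵝ :* p₁))) :* pₜ)
           refl (fromℕ N) (poch q⁻¹ t) (poch q⁻¹ r₁) (Q ^ℚ α) (poch q⁻¹ r₂) (Q ^ℚ β) ⟩
    (fromℕ N * ((Q ^ℚ α * poch q⁻¹ r₂) * (Q ^ℚ β * poch q⁻¹ r₁))) * poch q⁻¹ t
      ≡⟨ cong (λ f → (fromℕ N * f) * poch q⁻¹ t) (sym (cong₂ _*_ fibre₂≡ fibre₁≡)) ⟩
    (fromℕ N * (fromℕ fibre₂ * fromℕ fibre₁)) * poch q⁻¹ t
      ≡⟨ cong (_* poch q⁻¹ t) (trans (cong (fromℕ N *_) (sym (fromℕ-* fibre₂ fibre₁)))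
           (trans (sym (fromℕ-* N _)) (trans (cong fromℕ N*fibre≡pairs) (fromℕ-* pairs₂ pairs₁)))) ⟩
    (fromℕ pairs₂ * fromℕ pairs₁) * poch q⁻¹ t ≡⟨ ℚₚ.*-assoc (fromℕ pairs₂) (fromℕ pairs₁) (poch q⁻¹ t) ⟩
    fromℕ pairs₂ * (fromℕ pairs₁ * poch q⁻¹ t) ≡⟨ cong₂ _*_ pairs₂≡ pairs₁≡ ⟩
    (Q ^ℚ δ * poch q⁻¹ r₂) * (Q ^ℚ γ * poch q⁻¹ (t ℕ.+ r₁))
      ≡⟨ solve 4 (λ Qᵟ p₂ Qᵞ p → (Qᵟ :* p₂) :* (Qᵞ :* p) := ((Qᵞ :* Qᵟ) :* p₂) :* p)
           refl (Q ^ℚ δ) (poch q⁻¹ r₂) (Q ^ℚ γ) (poch q⁻¹ (t ℕ.+ r₁)) ⟩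
    ((Q ^ℚ γ * Q ^ℚ δ) * poch q⁻¹ r₂) * poch q⁻¹ (t ℕ.+ r₁)
      ≡⟨ cong (λ f → (f * poch q⁻¹ r₂) * poch q⁻¹ (t ℕ.+ r₁)) exponents ⟩
    ((Q ^ℚ τ * (Q ^ℚ α * Q ^ℚ β)) * poch q⁻¹ r₂) * poch q⁻¹ (t ℕ.+ r₁)
      ≡⟨ solve 5 (λ Qᵗ Qᵅ Qᵝ p₂ p → ((Qᵗ :* (Qᵅ :* Qᵝ)) :* p₂) :* p := (Qᵗ :* p) :* ((Qᵅ :* p₂) :* Qᵝ))
           refl (Q ^ℚ τ) (Q ^ℚ α) (Q ^ℚ β) (poch q⁻¹ r₂) (poch q⁻¹ (t ℕ.+ r₁)) ⟩
    (Q ^ℚ τ * poch q⁻¹ (t ℕ.+ r₁)) * C ≡⟨ cong (λ f → (f * poch q⁻¹ (t ℕ.+ r₁)) * C) (sym (fromℕ-q^ τ)) ⟩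
    (fromℕ (q ℕ.^ τ) * poch q⁻¹ (t ℕ.+ r₁)) * C ∎)
    where
    open ≡-Reasoning
    k l fibre₂ fibre₁ pairs₂ pairs₁ α β γ δ τ : ℕ
    k = (r₁ ℕ.+ j) ℕ.+ t
    l = r₂ ℕ.+ (r₁ ℕ.+ j)
    fibre₂ = extensionCount q l (r₁ ℕ.+ j) r₂
    fibre₁ = extensionCount q (r₁ ℕ.+ j) j r₁
    pairs₂ = extensionCount q (r₂ ℕ.+ k) k r₂
    pairs₁ = extensionCount q k j r₁
    α = r₂ ℕ.* l
    β = r₁ ℕ.* (r₁ ℕ.+ j)
    γ = r₁ ℕ.* k
    δ = r₂ ℕ.* (r₂ ℕ.+ k)
    τ = t ℕ.* (r₂ ℕ.+ r₁)
    C : ℚ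
    C = (Q ^ℚ α * poch q⁻¹ r₂) * Q ^ℚ β
    C≢0 : ¬ C ≡ 0ℚ
    C≢0 = x#0y#0→xy#0 (x#0y#0→xy#0 (Q^≢0 α) (poch≢0 r₂)) (Q^≢0 β)
    fibre₂≡ : fromℕ fibre₂ ≡ Q ^ℚ α * poch q⁻¹ r₂
    fibre₂≡ = extensionCount-closed r₂ refl
    fibre₁≡ : fromℕ fibre₁ ≡ Q ^ℚ β * poch q⁻¹ r₁
    fibre₁≡ = extensionCount-closed r₁ refl
    pairs₂≡ : fromℕ pairs₂ ≡ Q ^ℚ δ * poch q⁻¹ r₂
    pairs₂≡ = extensionCount-closed r₂ refl
    pairs₁≡ : fromℕ pairs₁ * poch q⁻¹ t ≡ Q ^ℚ γ * poch q⁻¹ (t ℕ.+ r₁)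
    pairs₁≡ = extensionCount-poch r₁ t (ℕₚ.+-comm t (r₁ ℕ.+ j))
    exponents : Q ^ℚ γ * Q ^ℚ δ ≡ Q ^ℚ τ * (Q ^ℚ α * Q ^ℚ β)
    exponents = begin
      Q ^ℚ γ * Q ^ℚ δ ≡⟨ sym (^ℚ-+ Q γ δ) ⟩
      Q ^ℚ (γ ℕ.+ δ) ≡⟨ cong (Q ^ℚ_) (exponent-identity r₂ r₁ j t) ⟩
      Q ^ℚ (τ ℕ.+ (α ℕ.+ β)) ≡⟨ trans (^ℚ-+ Q τ (α ℕ.+ β)) (cong (Q ^ℚ τ *_) (^ℚ-+ Q α β)) ⟩
      Q ^ℚ τ * (Q ^ℚ α * Q ^ℚ β) ∎

  private
    ∸-≡ : ∀ {a c} b → a ≡ c ℕ.+ b → a ℕ.∸ b ≡ c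
    ∸-≡ {c = c} b a≡c+b = trans (cong (ℕ._∸ b) a≡c+b) (ℕₚ.m+n∸n≡m c b)

  -- The dimension differences of the statement, for k = r₁ + j + t, l = r₂ + r₁ + j and m = r₂ + k.
  dimension-differences : ∀ r₂ r₁ j t →
    (r₂ ℕ.+ ((r₁ ℕ.+ j) ℕ.+ t)) ℕ.∸ (r₂ ℕ.+ (r₁ ℕ.+ j)) ≡ t ×
    ((r₁ ℕ.+ j) ℕ.+ t ℕ.+ (r₂ ℕ.+ (r₁ ℕ.+ j))) ℕ.∸ (j ℕ.+ (r₂ ℕ.+ ((r₁ ℕ.+ j) ℕ.+ t))) ≡ r₁ ×
    (r₂ ℕ.+ (r₁ ℕ.+ j)) ℕ.∸ j ≡ r₂ ℕ.+ r₁ ×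
    ((r₁ ℕ.+ j) ℕ.+ t) ℕ.∸ j ≡ t ℕ.+ r₁
  dimension-differences r₂ r₁ j t =
    ∸-≡ (r₂ ℕ.+ (r₁ ℕ.+ j)) (m≡ r₂ r₁ j t) , ∸-≡ (j ℕ.+ (r₂ ℕ.+ ((r₁ ℕ.+ j) ℕ.+ t))) (k+l≡ r₂ r₁ j t) ,
    ∸-≡ j (l≡ r₂ r₁ j) , ∸-≡ j (k≡ r₁ j t)
    where
    m≡ : ∀ r₂ r₁ j t → r₂ ℕ.+ ((r₁ ℕ.+ j) ℕ.+ t) ≡ t ℕ.+ (r₂ ℕ.+ (r₁ ℕ.+ j))
    m≡ = solve-∀
    k+l≡ : ∀ r₂ r₁ j t →
      (r₁ ℕ.+ j) ℕ.+ t ℕ.+ (r₂ ℕ.+ (r₁ ℕ.+ j)) ≡ r₁ ℕ.+ (j ℕ.+ (r₂ ℕ.+ ((r₁ ℕ.+ j) ℕ.+ t)))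
    k+l≡ = solve-∀
    l≡ : ∀ r₂ r₁ j → r₂ ℕ.+ (r₁ ℕ.+ j) ≡ (r₂ ℕ.+ r₁) ℕ.+ j
    l≡ = solve-∀
    k≡ : ∀ r₁ j t → (r₁ ℕ.+ j) ℕ.+ t ≡ (t ℕ.+ r₁) ℕ.+ j
    k≡ = solve-∀

  count-formula : ∀ N j r₁ r₂ {k l m} → r₁ ℕ.+ j ℕ.≤ k → r₂ ℕ.+ k ≡ m → r₂ ℕ.+ (r₁ ℕ.+ j) ≡ l →
    N ℕ.* (extensionCount q (r₂ ℕ.+ (r₁ ℕ.+ j)) (r₁ ℕ.+ j) r₂ ℕ.* extensionCount q (r₁ ℕ.+ j) j r₁)
      ≡ extensionCount q m k r₂ ℕ.* extensionCount q k j r₁ →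
    fromℕ N * (poch q⁻¹ (m ℕ.∸ l) * poch q⁻¹ ((k ℕ.+ l) ℕ.∸ (j ℕ.+ m)))
      ≡ fromℕ (q ℕ.^ ((m ℕ.∸ l) ℕ.* (l ℕ.∸ j))) * poch q⁻¹ (k ℕ.∸ j)
  count-formula N j r₁ r₂ r₁+j≤k refl refl N*fibre≡pairs with ℕₚ.m≤n⇒∃[o]m+o≡n r₁+j≤k
  ... | t , refl with dimension-differences r₂ r₁ j t
  ...   | m-l , k+l-j-m , l-j , k-j rewrite m-l | k+l-j-m | l-j | k-j =
    pochhammer-count N r₂ r₁ j t N*fibre≡pairs

open import Level using (Level)
open import Data.Nat using (ℕ; _≤_; _∸_; _+_; _*_; _^_)
open import Data.Product using (Σ; ∃; _×_; _,_)
open import Relation.Nullary using (¬_)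
open import Relation.Binary.PropositionalEquality using (_≡_)
open import Data.Rational using (ℚ) renaming (_*_ to _*ℚ_)

lemma2p14 : ∀ {c ℓ : Level} (F : FiniteField c ℓ) (n : ℕ) → 1 ≤ n →
    let open FiniteField F using (q) in
    let open Linear F n in
    (U W : Subspace) (j k l : ℕ) → HasDim U j → HasDim (U ⊕ W) k → j ≤ l → l ≤ n →
    (B : Subspace) (m : ℕ) → HasDim B m →
    (∃ λ A → HasDim A l × U ⊆ A × (A ⊕ W) ≈ₛ B) →
    Σ ℕ λ N →
      CountIs (λ A → HasDim A l × U ⊆ A × (A ⊕ W) ≈ₛ B) N ×
      CountIs (λ A → HasDim A l × U ⊆ A × A ⊆ B × (A ⊕ W) ≈ₛ B) N ×
      (∀ A → HasDim A l × U ⊆ A × A ⊆ B × (A ⊕ W) ≈ₛ B →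
         CountIs (λ A′ → HasDim A′ l × U ⊆ A′ × A′ ≈ₛ A × (A′ ⊕ W) ≈ₛ B) 1) ×
      (∀ A → ¬ (HasDim A l × U ⊆ A × A ⊆ B × (A ⊕ W) ≈ₛ B) →
         CountIs (λ A′ → HasDim A′ l × U ⊆ A′ × A′ ≈ₛ A × (A′ ⊕ W) ≈ₛ B) 0) ×
      (fromℕ N *ℚ (poch (inv q) (m ∸ l) *ℚ poch (inv q) ((k + l) ∸ (j + m)))
        ≡ fromℕ (q ^ ((m ∸ l) * (l ∸ j))) *ℚ poch (inv q) (k ∸ j))
lemma2p14 F n _ U W j k l (u , lin-u , u-basis) (z , lin-z , z-basis) _ _ B m (b , lin-b , b-basis)
  (A₀ , admissible-A₀) =
  N , count-admissible , count-admissible-⊆B , weight-in-support , weight-outside-support ,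
  count-formula N j r₁ r₂ r₁+j≤k dim-B dim-A length-admissibleSubspaces
  where
  open FiniteField F using (q)
  open Subspaces F n using (LinIndep⇒Independent; q≥2)
  open AdmissibleSubspaces.Setting F n U W j k l B m (LinIndep⇒Independent u lin-u) u-basis
    (LinIndep⇒Independent z lin-z) z-basis (LinIndep⇒Independent b lin-b) b-basis
  open Counting admissible-A₀
  open PochhammerIdentity q q≥2 using (count-formula)
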